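{- Let $0<\delta\le1/8$ with $1/\delta$ an integer, $3\le\ell\le5$ an integer, $\xi=\lceil\ell\log_{1+\delta}\frac1\delta\rceil$, and $0\le\zeta\le\frac1{\delta^{\ell+1}}-1$ an integer. Let $A_\zeta$ be an instance (without release dates) in which all sizes, weights and speeds are integer powers of $1+\delta$ and no job has a density $(1+\delta)^\beta$ with $\beta\in\{c\xi+1,\dots,(c+1)\xi\}$ for $c=v/\delta^{\ell+1}+\zeta$, $v$ an integer. Let $I_1,\dots,I_q$ be the non-empty sets of jobs obtained by grouping together jobs whose density exponents lie in a common interval $\{(v/\delta^{\ell+1}+\zeta+1)\xi+1,\dots,((v+1)/\delta^{\ell+1}+\zeta)\xi\}$, each regarded as an instance with the full set of machines. For each $p$ let $SOL_p$ be a solution for $I_p$ with $SOL_p(I_p)\le(1+\nu)OPT(I_p)$ for some $\nu>0$, and let $SOL$ be the combined solution in which each machine is assigned all jobs assigned to it by $SOL_1,\dots,SOL_q$. Then $SOL(A_\zeta)\le(1+\nu)(1+8\delta)OPT(A_\zeta)$.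
   Context: Scheduling without release dates on uniformly related machines, minimizing total weighted completion time. A solution is a partition of the jobs among the machines; for an instance $X$, $SOL(X)$ is the total weighted completion time when each machine processes its jobs from time $0$ without idle time in non-increasing order of density (weight/size). $OPT(X)$ is the optimal cost for $X$.
   Formalization: The parameter ν, the approximation factor of the solutions $SOL_p$, ranges over the positive rationals rather than the positive reals. -}

module Defs where

open import Data.Nat as ℕ using (ℕ; zero; suc; NonZero)
open import Data.Integer as ℤ using (ℤ; +_; -[1+_])
open import Data.Rational as ℚ using (ℚ; 0ℚ; 1ℚ; _/_; _⊓_)
open import Data.Fin using (Fin; zero; suc; toℕ)
open import Data.List using (List; []; _∷_; map; foldr; concatMap; allFin)
open import Data.Bool using (Bool; true; false; if_then_else_; _∧_; _∨_)
open import Data.Product using (_×_; Σ)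
open import Relation.Nullary.Decidable using (⌊_⌋)
open import Relation.Binary.PropositionalEquality using (_≡_)
import Data.Vec.Functional as VF
import Data.Fin as Fin

powℕ : ℚ → ℕ → ℚ
powℕ q zero    = 1ℚ
powℕ q (suc n) = q ℚ.* powℕ q n

-- (1+δ)^z for z ∈ ℤ, where δ = 1/k; note 1+δ = (k+1)/k, (1+δ)⁻¹ = k/(k+1)
onePlusδ^ : (k : ℕ) → .{{_ : NonZero k}} → ℤ → ℚ
onePlusδ^ k (+ n)    = powℕ ((+ suc k) / k) n
onePlusδ^ k -[1+ n ] = powℕ ((+ k) / suc k) (suc n)

Σℚ : (n : ℕ) → (Fin n → ℚ) → ℚ
Σℚ n f = foldr ℚ._+_ 0ℚ (map f (allFin n))

-- Instances: n jobs, (suc m) machines, all data integer powers of 1+δ,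
-- given by their exponents.

record Instance (n m : ℕ) : Set where
  field
    sizeExp   : Fin n → ℤ
    weightExp : Fin n → ℤ
    speedExp  : Fin (suc m) → ℤ

  densityExp : Fin n → ℤ
  densityExp j = weightExp j ℤ.- sizeExp j

open Instance public

Assignment : ℕ → ℕ → Set
Assignment n m = Fin n → Fin (suc m)

-- "j' is processed no later than j" in the non-increasing density order
-- (ties broken by job index; the cost does not depend on the tie-break).
precedes : ∀ {n m} → Instance n m → Fin n → Fin n → Bool
precedes X j' j =
  ⌊ densityExp X j ℤ.<? densityExp X j' ⌋ ∨
  (⌊ densityExp X j ℤ.≟ densityExp X j' ⌋ ∧ ⌊ toℕ j' ℕ.≤? toℕ j ⌋)

-- A set of jobs is given by a predicate on the job indices; the
-- sub-instance X|P has job set P and the full set of machines.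
JobSet : ℕ → Set
JobSet n = Fin n → Bool

allJobs : ∀ {n} → JobSet n
allJobs _ = true

module _ (k : ℕ) .{{_ : NonZero k}} {n m : ℕ} (X : Instance n m) where

  size : Fin n → ℚ
  size j = onePlusδ^ k (sizeExp X j)

  weight : Fin n → ℚ
  weight j = onePlusδ^ k (weightExp X j)

  invSpeed : Fin (suc m) → ℚ
  invSpeed i = onePlusδ^ k (ℤ.- speedExp X i)

  -- completion time of job j in the sub-instance X|P under assignment a:
  -- the machine processes its jobs (of P) from time 0 without idle time in
  -- non-increasing order of density.
  completion : JobSet n → Assignment n m → Fin n → ℚ
  completion P a j =
    invSpeed (a j) ℚ.*
      Σℚ n (λ j' → if P j' ∧ ⌊ a j' Fin.≟ a j ⌋ ∧ precedes X j' j
                   then size j' else 0ℚ)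

  cost : JobSet n → Assignment n m → ℚ
  cost P a = Σℚ n (λ j → if P j then weight j ℚ.* completion P a j else 0ℚ)

allAssignments : (n m : ℕ) → List (Assignment n m)
allAssignments zero    m = (λ ()) ∷ []
allAssignments (suc n) m =
  concatMap (λ i → map (λ f → i VF.∷ f) (allAssignments n m)) (allFin (suc m))

OPT : (k : ℕ) .{{_ : NonZero k}} {n m : ℕ} → Instance n m → JobSet n → ℚ
OPT k {n} {m} X P =
  foldr _⊓_ (cost k X P (λ _ → zero)) (map (cost k X P) (allAssignments n m))

-- ξ = ⌈ℓ log_{1+δ}(1/δ)⌉ : the least integer x with (1+δ)^x ≥ (1/δ)^ℓ = k^ℓ
-- (this integer is positive, since k^ℓ > 1).
IsXi : (k : ℕ) .{{_ : NonZero k}} → (ℓ ξ : ℕ) → Set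
IsXi k ℓ ξ =
  (((+ (k ℕ.^ ℓ)) / 1) ℚ.≤ onePlusδ^ k (+ ξ)) ×
  (∀ (x : ℕ) → x ℕ.< ξ → onePlusδ^ k (+ x) ℚ.< ((+ (k ℕ.^ ℓ)) / 1))

inGap : (k ℓ ξ ζ : ℕ) → ℤ → ℤ → Set
inGap k ℓ ξ ζ v β =
  ((c ℤ.* + ξ) ℤ.+ + 1 ℤ.≤ β) × (β ℤ.≤ (c ℤ.+ + 1) ℤ.* + ξ)
  where c = v ℤ.* + (k ℕ.^ (ℓ ℕ.+ 1)) ℤ.+ + ζ

blockJobs : (k ℓ ξ ζ : ℕ) → ∀ {n m} → Instance n m → ℤ → JobSet n
blockJobs k ℓ ξ ζ X v j =
  ⌊ (v ℤ.* + K ℤ.+ + ζ ℤ.+ + 1) ℤ.* + ξ ℤ.+ + 1 ℤ.≤? densityExp X j ⌋ ∧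
  ⌊ densityExp X j ℤ.≤? ((v ℤ.+ + 1) ℤ.* + K ℤ.+ + ζ) ℤ.* + ξ ⌋
  where K = k ℕ.^ (ℓ ℕ.+ 1)

module Submission where

-- With δ = 1/k, the jobs of A_ζ fall into density blocks I_v
-- separated by gaps of ξ unused density exponents, so densities in
-- different blocks differ by a factor at least (1+δ)^ξ ≥ k^ℓ ≥ 1/δ³.
--
-- The cost of a schedule is the sum over ordered pairs (i before j on
-- j's machine) of the delays σ w_j p_i.  Pairs inside a block give the
-- costs SOL(I_v); since the density order respects the blocks, the only
-- other pairs have i in a higher block than j.  On one machine this cross
-- cost X is bounded by (2δ + δ²)·T (T = the machine's total cost) by an
-- AM–GM argument per block together with the geometric growth of the block
-- densities (CrossTermBound).  Hence T ≤ (1 + 8δ)·S, where S is the sum of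
-- the block costs; S ≤ (1+ν)·Σ_v OPT(I_v) ≤ (1+ν)·OPT(A_ζ) gives the theorem.

module FiniteSums where

  open import Data.Nat using (ℕ; zero; suc)
  open import Data.Integer as ℤ using (ℤ; +_)
  import Data.Integer.Properties as ℤP
  open import Data.Rational using (ℚ; 0ℚ; _+_; _*_; _≤_)
  import Data.Rational.Properties as ℚP
  open import Data.List using (List; []; _∷_; map; foldr; tabulate; allFin)
  open import Data.Bool using (Bool; true; false; if_then_else_; _∧_)
  open import Data.Fin as Fin using (Fin; zero; suc)
  open import Data.Product using (_×_; _,_)
  open import Data.Empty using (⊥; ⊥-elim)
  open import Function using (_∘_; id)
  open import Data.Bool.Properties using (T-≡)
  open import Function.Bundles using (Equivalence)
  open import Relation.Nullary using (¬_)
  open import Relation.Nullary.Decidable using (Dec; ⌊_⌋; yes; no; toWitness; fromWitness)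
  open import Relation.Binary.PropositionalEquality
  open import Data.Rational.Solver
  open +-*-Solver

  -- Sum of a rational-valued function over a list; the sum Σℚ n f of the
  -- definitions is definitionally Σl (allFin n) f.
  Σl : ∀ {A : Set} → List A → (A → ℚ) → ℚ
  Σl xs f = foldr _+_ 0ℚ (map f xs)

  module _ {A : Set} where

    Σl-cong : (xs : List A) {f g : A → ℚ} → (∀ x → f x ≡ g x) → Σl xs f ≡ Σl xs g
    Σl-cong []       e = refl
    Σl-cong (x ∷ xs) e = cong₂ _+_ (e x) (Σl-cong xs e)

    Σl-mono : (xs : List A) {f g : A → ℚ} → (∀ x → f x ≤ g x) → Σl xs f ≤ Σl xs g
    Σl-mono []       e = ℚP.≤-refl
    Σl-mono (x ∷ xs) e = ℚP.+-mono-≤ (e x) (Σl-mono xs e)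

    Σl-+ : (xs : List A) (f g : A → ℚ) → Σl xs (λ x → f x + g x) ≡ Σl xs f + Σl xs g
    Σl-+ []       f g = refl
    Σl-+ (x ∷ xs) f g rewrite Σl-+ xs f g =
      solve 4 (λ a b c d → (a :+ b) :+ (c :+ d) := (a :+ c) :+ (b :+ d)) refl
        (f x) (g x) (Σl xs f) (Σl xs g)

    Σl-* : (xs : List A) (c : ℚ) (f : A → ℚ) → c * Σl xs f ≡ Σl xs (λ x → c * f x)
    Σl-* []       c f = ℚP.*-zeroʳ c
    Σl-* (x ∷ xs) c f rewrite sym (Σl-* xs c f) = ℚP.*-distribˡ-+ c (f x) (Σl xs f)

    Σl-zero : (xs : List A) {f : A → ℚ} → (∀ x → f x ≡ 0ℚ) → Σl xs f ≡ 0ℚ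
    Σl-zero []       e = refl
    Σl-zero (x ∷ xs) e rewrite e x | Σl-zero xs e = refl

    Σl-nonneg : (xs : List A) {f : A → ℚ} → (∀ x → 0ℚ ≤ f x) → 0ℚ ≤ Σl xs f
    Σl-nonneg xs {f} h = subst (_≤ Σl xs f) (Σl-zero xs (λ _ → refl)) (Σl-mono xs h)

  Σl-swap : ∀ {A B : Set} (xs : List A) (ys : List B) (f : A → B → ℚ) →
    Σl xs (λ x → Σl ys (f x)) ≡ Σl ys (λ y → Σl xs (λ x → f x y))
  Σl-swap []       ys f = sym (Σl-zero ys (λ _ → refl))
  Σl-swap (x ∷ xs) ys f rewrite Σl-swap xs ys f =
    sym (Σl-+ ys (f x) (λ y → Σl xs (λ x → f x y)))

  Σl-product : ∀ {A B : Set} (xs : List A) (ys : List B) (f : A → ℚ) (g : B → ℚ) →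
    Σl xs f * Σl ys g ≡ Σl xs (λ x → Σl ys (λ y → f x * g y))
  Σl-product xs ys f g = begin
    Σl xs f * Σl ys g            ≡⟨ ℚP.*-comm (Σl xs f) (Σl ys g) ⟩
    Σl ys g * Σl xs f            ≡⟨ Σl-* xs (Σl ys g) f ⟩
    Σl xs (λ x → Σl ys g * f x)  ≡⟨ Σl-cong xs (λ x → ℚP.*-comm (Σl ys g) (f x)) ⟩
    Σl xs (λ x → f x * Σl ys g)  ≡⟨ Σl-cong xs (λ x → Σl-* ys (f x) g) ⟩
    Σl xs (λ x → Σl ys (λ y → f x * g y)) ∎
    where open ≡-Reasoning

  ΣΣ : ∀ {A : Set} → List A → (A → A → ℚ) → ℚ
  ΣΣ xs f = Σl xs (λ j → Σl xs (f j))

  ΣΣ-cong : ∀ {A : Set} (xs : List A) {f g : A → A → ℚ} →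
    (∀ j i → f j i ≡ g j i) → ΣΣ xs f ≡ ΣΣ xs g
  ΣΣ-cong xs e = Σl-cong xs (λ j → Σl-cong xs (e j))

  ΣΣ-mono : ∀ {A : Set} (xs : List A) {f g : A → A → ℚ} →
    (∀ j i → f j i ≤ g j i) → ΣΣ xs f ≤ ΣΣ xs g
  ΣΣ-mono xs e = Σl-mono xs (λ j → Σl-mono xs (e j))

  ΣΣ-nonneg : ∀ {A : Set} (xs : List A) {f : A → A → ℚ} →
    (∀ j i → 0ℚ ≤ f j i) → 0ℚ ≤ ΣΣ xs f
  ΣΣ-nonneg xs h = Σl-nonneg xs (λ j → Σl-nonneg xs (h j))

  ΣΣ-+ : ∀ {A : Set} (xs : List A) (f g : A → A → ℚ) →
    ΣΣ xs (λ j i → f j i + g j i) ≡ ΣΣ xs f + ΣΣ xs g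
  ΣΣ-+ xs f g = trans (Σl-cong xs (λ j → Σl-+ xs (f j) (g j))) (Σl-+ xs _ _)

  ΣΣ-* : ∀ {A : Set} (xs : List A) (c : ℚ) (f : A → A → ℚ) →
    c * ΣΣ xs f ≡ ΣΣ xs (λ j i → c * f j i)
  ΣΣ-* xs c f = trans (Σl-* xs c _) (Σl-cong xs (λ j → Σl-* xs c (f j)))

  Σl-ΣΣ : ∀ {A B : Set} (ys : List B) (xs : List A) (f : B → A → A → ℚ) →
    Σl ys (λ v → ΣΣ xs (f v)) ≡ ΣΣ xs (λ j i → Σl ys (λ v → f v j i))
  Σl-ΣΣ ys xs f =
    trans (Σl-swap ys xs _) (Σl-cong xs (λ j → Σl-swap ys xs (λ v → f v j)))

  ind : Bool → ℚ → ℚ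
  ind b x = if b then x else 0ℚ

  ind-nonneg : ∀ b {x} → 0ℚ ≤ x → 0ℚ ≤ ind b x
  ind-nonneg true  h = h
  ind-nonneg false h = ℚP.≤-refl

  ind-≤ : ∀ b {x} → 0ℚ ≤ x → ind b x ≤ x
  ind-≤ true  h = ℚP.≤-refl
  ind-≤ false h = h

  ind-mono : ∀ b {x y} → x ≤ y → ind b x ≤ ind b y
  ind-mono true  h = h
  ind-mono false h = ℚP.≤-refl

  ind-*ˡ : ∀ b c x → c * ind b x ≡ ind b (c * x)
  ind-*ˡ true  c x = refl
  ind-*ˡ false c x = ℚP.*-zeroʳ c

  ind-*ʳ : ∀ b c x → ind b x * c ≡ ind b (x * c)
  ind-*ʳ true  c x = refl
  ind-*ʳ false c x = ℚP.*-zeroˡ c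

  ind-+ : ∀ b x y → ind b (x + y) ≡ ind b x + ind b y
  ind-+ true  x y = refl
  ind-+ false x y = refl

  ind-∧ : ∀ b b' x → ind (b ∧ b') x ≡ ind b (ind b' x)
  ind-∧ true  b' x = refl
  ind-∧ false b' x = refl

  ind-product : ∀ a b x y → ind a x * ind b y ≡ ind (a ∧ b) (x * y)
  ind-product true  true  x y = refl
  ind-product true  false x y = ℚP.*-zeroʳ x
  ind-product false b     x y = ℚP.*-zeroˡ (ind b y)

  ind-false : ∀ b {x} → (b ≡ true → ⊥) → ind b x ≡ 0ℚ
  ind-false true  h = ⊥-elim (h refl)
  ind-false false h = refl

  ind-≤-ind : ∀ b₁ b₂ {x y} → (b₁ ≡ true → b₂ ≡ true × x ≤ y) → 0ℚ ≤ y →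
    ind b₁ x ≤ ind b₂ y
  ind-≤-ind true  b₂ h hy with h refl
  ... | refl , le = le
  ind-≤-ind false b₂ h hy = ind-nonneg b₂ hy

  ind-partition : ∀ b₁ b₂ x → (b₁ ≡ true → b₂ ≡ true → ⊥) → (b₁ ≡ false → b₂ ≡ false → x ≡ 0ℚ) →
    x ≡ ind b₁ x + ind b₂ x
  ind-partition true  true  x excl h = ⊥-elim (excl refl refl)
  ind-partition true  false x excl h = sym (ℚP.+-identityʳ x)
  ind-partition false true  x excl h = sym (ℚP.+-identityˡ x)
  ind-partition false false x excl h = trans (h refl refl) refl

  ind-≡-ind : ∀ b₁ b₂ x → (b₁ ≡ true → b₂ ≡ true) → (b₂ ≡ true → b₁ ≡ true) →
    ind b₁ x ≡ ind b₂ x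
  ind-≡-ind true  b₂ x h h' rewrite h refl = refl
  ind-≡-ind false false x h h' = refl
  ind-≡-ind false true  x h h' with h' refl
  ... | ()

  ∧-proj₁ : ∀ a {b} → a ∧ b ≡ true → a ≡ true
  ∧-proj₁ true h = refl

  ∧-proj₂ : ∀ a {b} → a ∧ b ≡ true → b ≡ true
  ∧-proj₂ true h = h

  ∧-intro : ∀ {a b} → a ≡ true → b ≡ true → a ∧ b ≡ true
  ∧-intro refl refl = refl

  witness : ∀ {P : Set} (d : Dec P) → ⌊ d ⌋ ≡ true → P
  witness d e = toWitness (Equivalence.from T-≡ e)

  decide-true : ∀ {P : Set} (d : Dec P) → P → ⌊ d ⌋ ≡ true
  decide-true d x = Equivalence.to T-≡ (fromWitness x)

  refute : ∀ {P : Set} (d : Dec P) → ⌊ d ⌋ ≡ false → ¬ P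
  refute (yes x) ()
  refute (no ¬x) _ = ¬x

  ΣFin : (n : ℕ) → (Fin n → ℚ) → ℚ
  ΣFin zero    f = 0ℚ
  ΣFin (suc n) f = f zero + ΣFin n (f ∘ suc)

  Σl-tabulate : ∀ {A : Set} n (g : Fin n → A) (f : A → ℚ) →
    Σl (tabulate g) f ≡ ΣFin n (f ∘ g)
  Σl-tabulate zero    g f = refl
  Σl-tabulate (suc n) g f = cong (λ z → f (g zero) + z) (Σl-tabulate n (g ∘ suc) f)

  ΣFin-zero : ∀ n {f : Fin n → ℚ} → (∀ x → f x ≡ 0ℚ) → ΣFin n f ≡ 0ℚ
  ΣFin-zero zero    e = refl
  ΣFin-zero (suc n) e rewrite e zero | ΣFin-zero n (e ∘ suc) = refl

  ΣFin-cong : ∀ n {f g : Fin n → ℚ} → (∀ x → f x ≡ g x) → ΣFin n f ≡ ΣFin n g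
  ΣFin-cong zero    e = refl
  ΣFin-cong (suc n) e = cong₂ _+_ (e zero) (ΣFin-cong n (e ∘ suc))

  ≟-suc : ∀ {n} (x y : Fin n) → ⌊ suc x Fin.≟ suc y ⌋ ≡ ⌊ x Fin.≟ y ⌋
  ≟-suc x y with x Fin.≟ y
  ... | yes _ = refl
  ... | no  _ = refl

  ΣFin-select : ∀ n (y : Fin n) (g : Fin n → ℚ) →
    ΣFin n (λ μ → ind ⌊ y Fin.≟ μ ⌋ (g μ)) ≡ g y
  ΣFin-select (suc n) zero g =
    trans (cong (λ z → g zero + z) (ΣFin-zero n (λ _ → refl))) (ℚP.+-identityʳ (g zero))
  ΣFin-select (suc n) (suc y) g =
    trans (ℚP.+-identityˡ _)
      (trans (ΣFin-cong n (λ μ → cong (λ b → ind b (g (suc μ))) (≟-suc y μ)))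
             (ΣFin-select n y (g ∘ suc)))

  allFin-select : ∀ n (y : Fin n) (g : Fin n → ℚ) →
    Σl (allFin n) (λ μ → ind ⌊ y Fin.≟ μ ⌋ (g μ)) ≡ g y
  allFin-select n y g = trans (Σl-tabulate n id _) (ΣFin-select n y g)

  range : ℤ → ℕ → List ℤ
  range lo zero    = []
  range lo (suc N) = lo ∷ range (ℤ.suc lo) N

  range-below : ∀ N lo b (g : ℤ → ℚ) → b ℤ.≤ lo →
    Σl (range lo N) (λ v → ind ⌊ v ℤ.<? b ⌋ (g v)) ≡ 0ℚ
  range-below zero    lo b g h = refl
  range-below (suc N) lo b g h with lo ℤ.<? b
  ... | yes l = ⊥-elim (ℤP.<-irrefl refl (ℤP.<-≤-trans l h))
  ... | no  _ = trans (ℚP.+-identityˡ _) (range-below N (ℤ.suc lo) b g (ℤP.≤-trans h (ℤP.i≤suc[i] lo)))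

  i<suc[i] : ∀ i → i ℤ.< ℤ.suc i
  i<suc[i] i = ℤP.suc[i]≤j⇒i<j ℤP.≤-refl

  range-miss : ∀ N lo y (g : ℤ → ℚ) → y ℤ.< lo →
    Σl (range lo N) (λ v → ind ⌊ v ℤ.≟ y ⌋ (g v)) ≡ 0ℚ
  range-miss zero    lo y g h = refl
  range-miss (suc N) lo y g h with lo ℤ.≟ y
  ... | yes refl = ⊥-elim (ℤP.<-irrefl refl h)
  ... | no  _    = trans (ℚP.+-identityˡ _) (range-miss N (ℤ.suc lo) y g (ℤP.<-trans h (i<suc[i] lo)))

  range-select : ∀ N lo y (g : ℤ → ℚ) → lo ℤ.≤ y → y ℤ.< lo ℤ.+ + N →
    Σl (range lo N) (λ v → ind ⌊ v ℤ.≟ y ⌋ (g v)) ≡ g y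
  range-select zero lo y g h₁ h₂ =
    ⊥-elim (ℤP.<-irrefl refl (ℤP.≤-<-trans h₁ (subst (y ℤ.<_) (ℤP.+-identityʳ lo) h₂)))
  range-select (suc N) lo y g h₁ h₂ with lo ℤ.≟ y
  ... | yes refl = trans (cong (λ z → g lo + z) (range-miss N (ℤ.suc lo) lo g (i<suc[i] lo)))
                         (ℚP.+-identityʳ (g lo))
  ... | no ne = trans (ℚP.+-identityˡ _)
      (range-select N (ℤ.suc lo) y g (ℤP.i<j⇒suc[i]≤j (ℤP.≤∧≢⇒< h₁ ne)) (subst (y ℤ.<_) shift h₂))
    where
    shift : lo ℤ.+ + suc N ≡ ℤ.suc lo ℤ.+ + N
    shift = trans (cong (λ z → lo ℤ.+ z) (ℤP.pos-+ 1 N))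
           (trans (sym (ℤP.+-assoc lo (+ 1) (+ N))) (cong (ℤ._+ + N) (ℤP.+-comm lo (+ 1))))


module RationalFacts where

  open import Data.Nat as ℕ using (ℕ; suc)
  import Data.Nat.Properties as ℕP
  import Data.Integer as ℤ
  import Data.Integer.Properties as ℤP
  open import Data.Rational as ℚ using (ℚ; 0ℚ; 1ℚ; _+_; _*_; _-_; _≤_; _<_; _/_)
  import Data.Rational.Properties as ℚP
  import Data.Rational.Unnormalised as ℚᵘ
  import Data.Rational.Unnormalised.Properties as ℚᵘP
  open import Data.Sum using (inj₁; inj₂)
  open import Data.Empty using (⊥-elim)
  open import Relation.Binary using (tri<; tri≈; tri>)
  open import Relation.Binary.PropositionalEquality
  open import Data.Rational.Solver
  open +-*-Solver

  -- Sign and monotonicity facts, phrased with explicit hypotheses rather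
  -- than the instance arguments of the library versions.

  mul-nonneg : ∀ {a b} → 0ℚ ≤ a → 0ℚ ≤ b → 0ℚ ≤ a * b
  mul-nonneg {a} {b} ha hb =
    ℚP.nonNegative⁻¹ _ {{ℚP.nonNeg*nonNeg⇒nonNeg a {{ℚ.nonNegative ha}} b {{ℚ.nonNegative hb}}}}

  mul-pos : ∀ {a b} → 0ℚ < a → 0ℚ < b → 0ℚ < a * b
  mul-pos {a} {b} ha hb =
    ℚP.positive⁻¹ _ {{ℚP.pos*pos⇒pos a {{ℚ.positive ha}} b {{ℚ.positive hb}}}}

  +-nonneg : ∀ {a b} → 0ℚ ≤ a → 0ℚ ≤ b → 0ℚ ≤ a + b
  +-nonneg = ℚP.+-mono-≤

  *-monoˡ : ∀ {a b} c → 0ℚ ≤ c → a ≤ b → c * a ≤ c * b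
  *-monoˡ c hc h = ℚP.*-monoˡ-≤-nonNeg c {{ℚ.nonNegative hc}} h

  *-monoʳ : ∀ {a b} c → 0ℚ ≤ c → a ≤ b → a * c ≤ b * c
  *-monoʳ c hc h = ℚP.*-monoʳ-≤-nonNeg c {{ℚ.nonNegative hc}} h

  *-mono : ∀ {a b c d} → 0ℚ ≤ b → 0ℚ ≤ c → a ≤ b → c ≤ d → a * c ≤ b * d
  *-mono {c = c} {d} hb hc h₁ h₂ = ℚP.≤-trans (*-monoʳ c hc h₁) (*-monoˡ _ hb h₂)

  *-cancelˡ : ∀ {x y} D → 0ℚ < D → D * x ≤ D * y → x ≤ y
  *-cancelˡ D hD h = ℚP.*-cancelˡ-≤-pos D {{ℚ.positive hD}} h

  square-nonneg : ∀ x → 0ℚ ≤ x * x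
  square-nonneg x with ℚP.≤-total 0ℚ x
  ... | inj₁ h = mul-nonneg h h
  ... | inj₂ h = ℚP.nonNegative⁻¹ _ {{ℚP.nonPos*nonPos⇒nonPos x {{ℚ.nonPositive h}} x {{ℚ.nonPositive h}}}}

  ≤-by : ∀ {x y} s → 0ℚ ≤ s → y ≡ x + s → x ≤ y
  ≤-by {x} s hs refl = subst (_≤ x + s) (ℚP.+-identityʳ x) (ℚP.+-monoʳ-≤ x hs)

  halve : ∀ {x y} → x + x ≤ y + y → x ≤ y
  halve {x} {y} h with ℚP.<-cmp x y
  ... | tri< l _ _ = ℚP.<⇒≤ l
  ... | tri≈ _ e _ = ℚP.≤-reflexive e
  ... | tri> _ _ g = ⊥-elim (ℚP.<-irrefl refl (ℚP.≤-<-trans h (ℚP.+-mono-< g g)))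

  -- Weighted AM–GM step used for a single density block.  With κε = 1,
  -- W² ≤ 2Uc and Uκ³ ≤ D, we get 2WP ≤ εDP² + 2ε²c: multiply by D and use
  --   εD²P² + κW² = 2DWP + κ(εDP − W)².
  block-am-gm : ∀ {κ ε D P W c U} → κ * ε ≡ 1ℚ → 0ℚ ≤ κ → 0ℚ ≤ ε → 0ℚ < D → 0ℚ ≤ c →
    W * W ≤ U * c + U * c → U * (κ * κ * κ) ≤ D →
    W * P + W * P ≤ ε * (D * (P * P)) + (ε * ε) * (c + c)
  block-am-gm {κ} {ε} {D} {P} {W} {c} {U} κε hκ hε hD hc hW hU = *-cancelˡ D hD (begin
    D * (W * P + W * P)
      ≤⟨ ≤-by _ (mul-nonneg hκ (square-nonneg (ε * D * P - W))) completeSquare ⟩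
    ε * (D * D * (P * P)) + κ * (W * W)
      ≤⟨ ℚP.+-monoʳ-≤ (ε * (D * D * (P * P))) (*-monoˡ κ hκ hW) ⟩
    ε * (D * D * (P * P)) + κ * (U * c + U * c)
      ≡⟨ cong (ε * (D * D * (P * P)) +_) (sym rescale) ⟩
    ε * (D * D * (P * P)) + (ε * ε) * (c + c) * (U * (κ * κ * κ))
      ≤⟨ ℚP.+-monoʳ-≤ (ε * (D * D * (P * P))) (*-monoˡ _ (mul-nonneg (mul-nonneg hε hε) (+-nonneg hc hc)) hU) ⟩
    ε * (D * D * (P * P)) + (ε * ε) * (c + c) * D
      ≡⟨ solve 5 (λ ε D P c e → ε :* (D :* D :* (P :* P)) :+ e :* (c :+ c) :* D
                               := D :* (ε :* (D :* (P :* P)) :+ e :* (c :+ c))) refl ε D P c (ε * ε) ⟩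
    D * (ε * (D * (P * P)) + (ε * ε) * (c + c)) ∎)
    where
    open ℚP.≤-Reasoning
    -- the identity holds up to a multiple of 1 − κε, which vanishes
    completeSquare : ε * (D * D * (P * P)) + κ * (W * W)
                     ≡ D * (W * P + W * P) + κ * ((ε * D * P - W) * (ε * D * P - W))
    completeSquare = begin-equality
      ε * (D * D * (P * P)) + κ * (W * W)
        ≡⟨ solve 5 (λ κ ε D P W → ε :* (D :* D :* (P :* P)) :+ κ :* (W :* W)
                     := D :* (W :* P :+ W :* P) :+ κ :* ((ε :* D :* P :- W) :* (ε :* D :* P :- W))
                        :+ (con 1ℚ :- κ :* ε) :* (ε :* D :* D :* P :* P :- (D :* P :* W :+ D :* P :* W)))
                  refl κ ε D P W ⟩
      sq + (1ℚ - κ * ε) * r ≡⟨ cong (λ t → sq + (1ℚ - t) * r) κε ⟩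
      sq + (1ℚ - 1ℚ) * r    ≡⟨ solve 2 (λ s r → s :+ (con 1ℚ :- con 1ℚ) :* r := s) refl sq r ⟩
      sq ∎
      where
      sq r : ℚ
      sq = D * (W * P + W * P) + κ * ((ε * D * P - W) * (ε * D * P - W))
      r  = ε * D * D * P * P - (D * P * W + D * P * W)
    rescale : (ε * ε) * (c + c) * (U * (κ * κ * κ)) ≡ κ * (U * c + U * c)
    rescale = begin-equality
      (ε * ε) * (c + c) * (U * (κ * κ * κ))
        ≡⟨ solve 4 (λ κ ε c U → (ε :* ε) :* (c :+ c) :* (U :* (κ :* κ :* κ))
                               := (κ :* ε) :* (κ :* ε) :* κ :* (U :* c :+ U :* c)) refl κ ε c U ⟩
      (κ * ε) * (κ * ε) * κ * (U * c + U * c) ≡⟨ cong (λ t → t * t * κ * (U * c + U * c)) κε ⟩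
      1ℚ * 1ℚ * κ * (U * c + U * c)
        ≡⟨ solve 3 (λ κ U c → con 1ℚ :* con 1ℚ :* κ :* (U :* c :+ U :* c) := κ :* (U :* c :+ U :* c)) refl κ U c ⟩
      κ * (U * c + U * c) ∎

  fromℕ : ℕ → ℚ
  fromℕ a = (ℤ.+ a) / 1

  private
    toℚᵘ-/ : ∀ i n → ℚ.toℚᵘ (i / suc n) ℚᵘ.≃ ℚᵘ.mkℚᵘ i n
    toℚᵘ-/ i n = ℚP.toℚᵘ-fromℚᵘ (ℚᵘ.mkℚᵘ i n)

    /-*-/ : ∀ i n j m x → ℚᵘ.mkℚᵘ i n ℚᵘ.* ℚᵘ.mkℚᵘ j m ℚᵘ.≃ ℚ.toℚᵘ x →
      (i / suc n) * (j / suc m) ≡ x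
    /-*-/ i n j m x h = ℚP.toℚᵘ-injective
      (ℚᵘP.≃-trans (ℚP.toℚᵘ-homo-* (i / suc n) (j / suc m))
        (ℚᵘP.≃-trans (ℚᵘP.*-cong (toℚᵘ-/ i n) (toℚᵘ-/ j m)) h))

  fromℕ-* : ∀ a b → fromℕ (a ℕ.* b) ≡ fromℕ a * fromℕ b
  fromℕ-* a b = sym (/-*-/ (ℤ.+ a) 0 (ℤ.+ b) 0 (fromℕ (a ℕ.* b))
    (ℚᵘP.≃-trans (ℚᵘ.*≡* (cong (ℤ._* ℤ.+ 1) (sym (ℤP.pos-* a b)))) (ℚᵘP.≃-sym (toℚᵘ-/ (ℤ.+ (a ℕ.* b)) 0))))

  fromℕ-+ : ∀ a b → fromℕ (a ℕ.+ b) ≡ fromℕ a + fromℕ b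
  fromℕ-+ a b = ℚP.toℚᵘ-injective (ℚᵘP.≃-trans (toℚᵘ-/ (ℤ.+ (a ℕ.+ b)) 0)
    (ℚᵘP.≃-sym (ℚᵘP.≃-trans (ℚP.toℚᵘ-homo-+ (fromℕ a) (fromℕ b))
      (ℚᵘP.≃-trans (ℚᵘP.+-cong (toℚᵘ-/ (ℤ.+ a) 0) (toℚᵘ-/ (ℤ.+ b) 0))
        (ℚᵘ.*≡* (cong (ℤ._* ℤ.+ 1)
          (trans (cong₂ ℤ._+_ (ℤP.*-identityʳ (ℤ.+ a)) (ℤP.*-identityʳ (ℤ.+ b))) (sym (ℤP.pos-+ a b)))))))))

  fromℕ-mono : ∀ {a b} → a ℕ.≤ b → fromℕ a ≤ fromℕ b
  fromℕ-mono {a} {b} h = ℚP.toℚᵘ-cancel-≤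
    (ℚᵘP.≤-respʳ-≃ (ℚᵘP.≃-sym (toℚᵘ-/ (ℤ.+ b) 0)) (ℚᵘP.≤-respˡ-≃ (ℚᵘP.≃-sym (toℚᵘ-/ (ℤ.+ a) 0))
      (ℚᵘ.*≤* (ℤP.*-monoʳ-≤-nonNeg (ℤ.+ 1) (ℤ.+≤+ h)))))

  fromℕ-nonneg : ∀ a → 0ℚ ≤ fromℕ a
  fromℕ-nonneg a = fromℕ-mono {0} {a} ℕ.z≤n

  /-inverse : ∀ a b → ((ℤ.+ suc a) / suc b) * ((ℤ.+ suc b) / suc a) ≡ 1ℚ
  /-inverse a b = /-*-/ (ℤ.+ suc a) b (ℤ.+ suc b) a 1ℚ (ℚᵘ.*≡* eq)
    where
    eq : (ℤ.+ suc a ℤ.* ℤ.+ suc b) ℤ.* ℤ.+ 1 ≡ ℤ.+ 1 ℤ.* ℤ.+ (suc b ℕ.* suc a)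
    eq = trans (ℤP.*-identityʳ _) (trans (sym (ℤP.pos-* (suc a) (suc b)))
           (trans (cong ℤ.+_ (ℕP.*-comm (suc a) (suc b))) (sym (ℤP.*-identityˡ _))))

  /-as-* : ∀ a b → (ℤ.+ a) / suc b ≡ fromℕ a * ((ℤ.+ 1) / suc b)
  /-as-* a b = sym (/-*-/ (ℤ.+ a) 0 (ℤ.+ 1) b ((ℤ.+ a) / suc b)
    (ℚᵘP.≃-trans (ℚᵘ.*≡* eq) (ℚᵘP.≃-sym (toℚᵘ-/ (ℤ.+ a) b))))
    where
    eq : (ℤ.+ a ℤ.* ℤ.+ 1) ℤ.* ℤ.+ suc b ≡ ℤ.+ a ℤ.* ℤ.+ (1 ℕ.* suc b)
    eq = trans (cong (ℤ._* ℤ.+ suc b) (ℤP.*-identityʳ (ℤ.+ a)))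
               (cong (λ x → ℤ.+ a ℤ.* ℤ.+ x) (sym (ℕP.*-identityˡ (suc b))))

  /-pos : ∀ a b → 0ℚ < (ℤ.+ suc a) / suc b
  /-pos a b = ℚP.toℚᵘ-cancel-<
    (ℚᵘP.<-respʳ-≃ (ℚᵘP.≃-sym (toℚᵘ-/ (ℤ.+ suc a) b)) (ℚᵘ.*<* (ℤ.+<+ (ℕ.s≤s ℕ.z≤n))))

  /-nonneg : ∀ a b → 0ℚ ≤ (ℤ.+ a) / suc b
  /-nonneg a b = ℚP.toℚᵘ-cancel-≤ (ℚᵘP.≤-respʳ-≃ (ℚᵘP.≃-sym (toℚᵘ-/ (ℤ.+ a) b))
    (ℚᵘ.*≤* (subst (ℤ.+ 0 ℤ.≤_) (sym (ℤP.*-identityʳ (ℤ.+ a))) (ℤ.+≤+ ℕ.z≤n))))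

  /-≥1 : ∀ b → 1ℚ ≤ (ℤ.+ suc (suc b)) / suc b
  /-≥1 b = ℚP.toℚᵘ-cancel-≤ (ℚᵘP.≤-respʳ-≃ (ℚᵘP.≃-sym (toℚᵘ-/ (ℤ.+ suc (suc b)) b))
    (ℚᵘ.*≤* (subst₂ ℤ._≤_ (sym (ℤP.*-identityˡ (ℤ.+ suc b))) (sym (ℤP.*-identityʳ (ℤ.+ suc (suc b))))
                           (ℤ.+≤+ (ℕP.n≤1+n (suc b))))))

  -- Absorbing the cross term: if T = S + X and X ≤ (2ε + ε²)T with
  -- 0 ≤ ε ≤ 1/8, then T ≤ (1 + 8ε)S, because
  --   (1 + 8ε)(1 − 2ε − ε²) − 1 = ε(240ε² + 79ε(1 − 8ε) + 6(1 − 8ε)²) ≥ 0.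
  absorb-cross : ∀ {T S X ε} → T ≡ S + X → X ≤ ((ε + ε) + ε * ε) * T → 0ℚ ≤ T → 0ℚ ≤ ε →
    fromℕ 8 * ε ≤ 1ℚ → T ≤ (1ℚ + fromℕ 8 * ε) * S
  absorb-cross {T} {S} {X} {ε} eT hX hT hε h8 = begin
    T ≤⟨ ≤-by (T * slack) (mul-nonneg hT slack≥0) refl ⟩
    T + T * slack
      ≡⟨ solve 3 (λ T e8 α → T :+ T :* (e8 :- α :- α :* e8) := (con 1ℚ :+ e8) :* (T :- α :* T)) refl T e8 α ⟩
    (1ℚ + e8) * (T - α * T)
      ≤⟨ *-monoˡ (1ℚ + e8) (+-nonneg (ℚP.nonNegative⁻¹ 1ℚ) (mul-nonneg (fromℕ-nonneg 8) hε))
           (ℚP.+-monoʳ-≤ T (ℚP.neg-antimono-≤ hX)) ⟩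
    (1ℚ + e8) * (T - X) ≡⟨ cong (λ t → (1ℚ + e8) * (t - X)) eT ⟩
    (1ℚ + e8) * (S + X - X) ≡⟨ cong ((1ℚ + e8) *_) (solve 2 (λ S X → S :+ X :- X := S) refl S X) ⟩
    (1ℚ + e8) * S ∎
    where
    open ℚP.≤-Reasoning
    α e8 s slack : ℚ
    α = (ε + ε) + ε * ε
    e8 = fromℕ 8 * ε
    s = 1ℚ - e8
    slack = e8 - α - α * e8
    s≥0 : 0ℚ ≤ s
    s≥0 = subst (_≤ s) (ℚP.+-inverseʳ e8) (ℚP.+-monoˡ-≤ (ℚ.- e8) h8)
    slack≥0 : 0ℚ ≤ slack
    slack≥0 = subst (0ℚ ≤_)
      (sym (solve 1 (λ e → con (fromℕ 8) :* e :- ((e :+ e) :+ e :* e) :- ((e :+ e) :+ e :* e) :* (con (fromℕ 8) :* e)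
             := e :* (con (fromℕ 240) :* (e :* e) :+ con (fromℕ 79) :* (e :* (con 1ℚ :- con (fromℕ 8) :* e))
                      :+ con (fromℕ 6) :* ((con 1ℚ :- con (fromℕ 8) :* e) :* (con 1ℚ :- con (fromℕ 8) :* e)))) refl ε))
      (mul-nonneg hε (+-nonneg (+-nonneg (mul-nonneg (fromℕ-nonneg 240) (mul-nonneg hε hε))
                                         (mul-nonneg (fromℕ-nonneg 79) (mul-nonneg hε s≥0)))
                               (mul-nonneg (fromℕ-nonneg 6) (mul-nonneg s≥0 s≥0))))


module Powers where

  open import Defs using (powℕ; onePlusδ^)
  open RationalFacts
  open import Data.Nat as ℕ using (ℕ; zero; suc)
  import Data.Nat.Properties as ℕP
  open import Data.Integer as ℤ using (ℤ; +_; -[1+_])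
  import Data.Integer.Properties as ℤP
  open import Data.Rational as ℚ using (ℚ; 0ℚ; 1ℚ; _*_; _≤_; _<_; _/_)
  import Data.Rational.Properties as ℚP
  open import Relation.Binary.PropositionalEquality
  open import Relation.Nullary.Decidable using (toWitness)
  open import Data.Empty using (⊥-elim)
  open import Data.Rational.Solver
  open +-*-Solver

  powℕ-pos : ∀ {x} n → 0ℚ < x → 0ℚ < powℕ x n
  powℕ-pos zero    h = ℚP.positive⁻¹ 1ℚ
  powℕ-pos (suc n) h = mul-pos h (powℕ-pos n h)

  powℕ-≥1 : ∀ {x} n → 1ℚ ≤ x → 1ℚ ≤ powℕ x n
  powℕ-≥1 zero    h = ℚP.≤-refl
  powℕ-≥1 (suc n) h = ℚP.≤-trans (ℚP.≤-reflexive (sym (ℚP.*-identityˡ 1ℚ)))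
    (*-mono (ℚP.≤-trans (ℚP.nonNegative⁻¹ 1ℚ) h) (ℚP.nonNegative⁻¹ 1ℚ) h (powℕ-≥1 n h))

  powℕ-snoc : ∀ x n → powℕ x (n ℕ.+ 1) ≡ powℕ x n * x
  powℕ-snoc x zero    = trans (ℚP.*-identityʳ x) (sym (ℚP.*-identityˡ x))
  powℕ-snoc x (suc n) rewrite powℕ-snoc x n = sym (ℚP.*-assoc x (powℕ x n) x)

  module OnePlusδPowers (k' : ℕ) where

    k : ℕ
    k = suc k'

    q r : ℚ
    q = (+ suc k) / k
    r = (+ k) / suc k

    qpow : ℤ → ℚ
    qpow z = onePlusδ^ k z

    r*q≡1 : r * q ≡ 1ℚ
    r*q≡1 = /-inverse k' k

    qpow-pos : ∀ z → 0ℚ < qpow z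
    qpow-pos (+ n)    = powℕ-pos n (/-pos k k')
    qpow-pos -[1+ n ] = powℕ-pos (suc n) (/-pos k' k)

    qpow-nonneg : ∀ z → 0ℚ ≤ qpow z
    qpow-nonneg z = ℚP.<⇒≤ (qpow-pos z)

    qpow-suc : ∀ z → qpow (z ℤ.+ + 1) ≡ qpow z * q
    qpow-suc (+ n)            = powℕ-snoc q n
    qpow-suc -[1+ zero ]      = sym (trans (cong (_* q) (ℚP.*-identityʳ r)) r*q≡1)
    qpow-suc -[1+ suc n ]     = sym (begin
      r * (r * powℕ r n) * q
        ≡⟨ solve 3 (λ r q x → r :* (r :* x) :* q := r :* x :* (r :* q)) refl r q (powℕ r n) ⟩
      r * powℕ r n * (r * q) ≡⟨ cong (r * powℕ r n *_) r*q≡1 ⟩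
      r * powℕ r n * 1ℚ      ≡⟨ ℚP.*-identityʳ _ ⟩
      r * powℕ r n ∎)
      where open ≡-Reasoning

    qpow-+ℕ : ∀ z n → qpow (z ℤ.+ + n) ≡ qpow z * powℕ q n
    qpow-+ℕ z zero    = trans (cong qpow (ℤP.+-identityʳ z)) (sym (ℚP.*-identityʳ _))
    qpow-+ℕ z (suc n) = begin
      qpow (z ℤ.+ + suc n)       ≡⟨ cong qpow shift ⟩
      qpow ((z ℤ.+ + n) ℤ.+ + 1) ≡⟨ qpow-suc (z ℤ.+ + n) ⟩
      qpow (z ℤ.+ + n) * q       ≡⟨ cong (_* q) (qpow-+ℕ z n) ⟩
      qpow z * powℕ q n * q      ≡⟨ ℚP.*-assoc (qpow z) (powℕ q n) q ⟩
      qpow z * (powℕ q n * q)    ≡⟨ cong (qpow z *_) (ℚP.*-comm (powℕ q n) q) ⟩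
      qpow z * powℕ q (suc n) ∎
      where
      open ≡-Reasoning
      shift : z ℤ.+ + suc n ≡ (z ℤ.+ + n) ℤ.+ + 1
      shift = trans (cong (λ x → z ℤ.+ + x) (ℕP.+-comm 1 n)) (sym (ℤP.+-assoc z (+ n) (+ 1)))

    qpow-+ : ∀ z w → qpow (z ℤ.+ w) ≡ qpow z * qpow w
    qpow-+ z (+ n)    = qpow-+ℕ z n
    qpow-+ z -[1+ n ] = begin
      qpow z'                                     ≡⟨ sym (ℚP.*-identityʳ _) ⟩
      qpow z' * 1ℚ                                ≡⟨ cong (qpow z' *_) (sym inverse) ⟩
      qpow z' * (qpow -[1+ n ] * powℕ q (suc n))
        ≡⟨ solve 3 (λ a b c → a :* (b :* c) := a :* c :* b) refl (qpow z') (qpow -[1+ n ]) (powℕ q (suc n)) ⟩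
      qpow z' * powℕ q (suc n) * qpow -[1+ n ]    ≡⟨ cong (_* qpow -[1+ n ]) (sym (qpow-+ℕ z' (suc n))) ⟩
      qpow (z' ℤ.+ + suc n) * qpow -[1+ n ]       ≡⟨ cong (λ x → qpow x * qpow -[1+ n ]) cancel ⟩
      qpow z * qpow -[1+ n ] ∎
      where
      open ≡-Reasoning
      z' = z ℤ.+ -[1+ n ]
      n-n : -[1+ n ] ℤ.+ + suc n ≡ + 0
      n-n = ℤP.n⊖n≡0 (suc n)
      cancel : z' ℤ.+ + suc n ≡ z
      cancel = trans (ℤP.+-assoc z -[1+ n ] (+ suc n)) (trans (cong (λ x → z ℤ.+ x) n-n) (ℤP.+-identityʳ z))
      inverse : qpow -[1+ n ] * powℕ q (suc n) ≡ 1ℚ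
      inverse = trans (sym (qpow-+ℕ -[1+ n ] (suc n))) (cong qpow n-n)

    qpow-mono : ∀ {z w} → z ℤ.≤ w → qpow z ≤ qpow w
    qpow-mono {z} {w} h = begin
      qpow z               ≡⟨ sym (ℚP.*-identityʳ _) ⟩
      qpow z * 1ℚ          ≤⟨ *-monoˡ (qpow z) (qpow-nonneg z) (powℕ-≥1 d (/-≥1 k')) ⟩
      qpow z * qpow (+ d)  ≡⟨ sym (qpow-+ z (+ d)) ⟩
      qpow (z ℤ.+ + d)     ≡⟨ cong qpow z+d≡w ⟩
      qpow w ∎
      where
      open ℚP.≤-Reasoning
      d = ℤ.∣ w ℤ.- z ∣
      z+d≡w : z ℤ.+ + d ≡ w
      z+d≡w = trans (cong (λ x → z ℤ.+ x) (ℤP.0≤i⇒+∣i∣≡i (ℤP.i≤j⇒0≤j-i h)))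
        (trans (cong (λ x → z ℤ.+ x) (ℤP.+-comm w (ℤ.- z)))
          (trans (sym (ℤP.+-assoc z (ℤ.- z) w)) (trans (cong (ℤ._+ w) (ℤP.+-inverseʳ z)) (ℤP.+-identityˡ w))))

    -- (1+δ)⁰ = 1 < 2
    q^x≥2⇒x≥1 : ∀ x → fromℕ 2 ≤ qpow (+ x) → 1 ℕ.≤ x
    q^x≥2⇒x≥1 zero    2≤1 = ⊥-elim (ℚP.<-irrefl refl (ℚP.≤-<-trans 2≤1 (toWitness {a? = 1ℚ ℚ.<? fromℕ 2} _)))
    q^x≥2⇒x≥1 (suc x) _   = ℕ.s≤s ℕ.z≤n


module ScheduleCost where

  open import Defs
  open FiniteSums
  open RationalFacts
  open Powers
  open import Data.Nat as ℕ using (ℕ; zero; suc)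
  import Data.Integer as ℤ
  open import Data.Rational using (ℚ; 0ℚ; _*_; _≤_; _⊓_)
  import Data.Rational.Properties as ℚP
  open import Data.List using (List; []; _∷_; map; foldr; allFin)
  open import Data.List.Relation.Unary.Any using (here; there)
  open import Data.List.Membership.Propositional using (_∈_; lose)
  open import Data.List.Membership.Propositional.Properties using (∈-map⁺; ∈-concatMap⁺; ∈-allFin)
  open import Data.Bool using (Bool; true; false; _∧_; _∨_)
  open import Data.Bool.Properties using (∨-zeroʳ)
  import Data.Nat.Properties as ℕP
  import Data.Integer.Properties as ℤP
  open import Relation.Binary using (tri<; tri≈; tri>)
  open import Data.Fin as Fin using (Fin; zero; suc; toℕ)
  open import Data.Product using (Σ; _×_; _,_)
  open import Data.Sum using (inj₁; inj₂)
  open import Data.Empty using (⊥; ⊥-elim)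
  open import Function using (_∘_)
  open import Relation.Nullary.Decidable using (⌊_⌋; yes; no)
  open import Relation.Binary.PropositionalEquality
  import Data.Vec.Functional as VF
  import Algebra.Construct.NaturalChoice.MinOp as MinOp
  private module Min = MinOp ℚP.⊓-operator

  foldr-⊓-≤ : ∀ {A : Set} (b : ℚ) (xs : List A) (g : A → ℚ) {x} → x ∈ xs →
    foldr _⊓_ b (map g xs) ≤ g x
  foldr-⊓-≤ b (y ∷ xs) g (here refl) = Min.x⊓y≤x (g y) _
  foldr-⊓-≤ b (y ∷ xs) g (there h)   = ℚP.≤-trans (Min.x⊓y≤y (g y) _) (foldr-⊓-≤ b xs g h)

  foldr-⊓-attained : ∀ {A : Set} (a₀ : A) (xs : List A) (g : A → ℚ) →
    Σ A λ o → foldr _⊓_ (g a₀) (map g xs) ≡ g o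
  foldr-⊓-attained a₀ [] g = a₀ , refl
  foldr-⊓-attained a₀ (y ∷ xs) g with foldr-⊓-attained a₀ xs g | ℚP.⊓-sel (g y) (foldr _⊓_ (g a₀) (map g xs))
  ... | o , e | inj₁ e' = y , e'
  ... | o , e | inj₂ e' = o , trans e' e

  allAssignments-complete : ∀ n m (s : Assignment n m) →
    Σ (Assignment n m) λ f → (f ∈ allAssignments n m) × (∀ j → f j ≡ s j)
  allAssignments-complete zero m s = (λ ()) , here refl , λ ()
  allAssignments-complete (suc n) m s with allAssignments-complete n m (s ∘ suc)
  ... | f , f∈ , f≗ = (s zero VF.∷ f) , ∈-concatMap⁺ (λ i → map (i VF.∷_) (allAssignments n m))
                                           (lose (∈-allFin (s zero)) (∈-map⁺ (s zero VF.∷_) f∈)) , agree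
    where
    agree : ∀ j → (s zero VF.∷ f) j ≡ s j
    agree zero    = refl
    agree (suc j) = f≗ j

  module Schedules (k' : ℕ) {n m : ℕ} (A : Instance n m) where

    open OnePlusδPowers k'

    jobs : List (Fin n)
    jobs = allFin n

    machines : List (Fin (suc m))
    machines = allFin (suc m)

    w p : Fin n → ℚ
    w = weight k A
    p = size k A

    σ : Fin (suc m) → ℚ
    σ = invSpeed k A

    prec : Fin n → Fin n → Bool
    prec = precedes A

    precedes⇒≥ : ∀ i j → prec i j ≡ true → densityExp A j ℤ.≤ densityExp A i
    precedes⇒≥ i j h with densityExp A j ℤ.<? densityExp A i | densityExp A j ℤ.≟ densityExp A i
    ... | yes l | _     = ℤP.<⇒≤ l
    ... | no  _ | yes e = ℤP.≤-reflexive e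
    ... | no  _ | no  _ = ⊥-elim (false≢true h)
      where
      false≢true : false ≡ true → ⊥
      false≢true ()

    >⇒precedes : ∀ i j → densityExp A j ℤ.< densityExp A i → prec i j ≡ true
    >⇒precedes i j l = cong (_∨ (⌊ densityExp A j ℤ.≟ densityExp A i ⌋ ∧ ⌊ toℕ i ℕ.≤? toℕ j ⌋))
                            (decide-true (densityExp A j ℤ.<? densityExp A i) l)

    tie⇒precedes : ∀ i j → densityExp A j ≡ densityExp A i → toℕ i ℕ.≤ toℕ j → prec i j ≡ true
    tie⇒precedes i j e le =
      trans (cong (⌊ densityExp A j ℤ.<? densityExp A i ⌋ ∨_)
                  (∧-intro (decide-true (densityExp A j ℤ.≟ densityExp A i) e) (decide-true (toℕ i ℕ.≤? toℕ j) le)))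
            (∨-zeroʳ _)

    precedes-total : ∀ i j → prec i j ∨ prec j i ≡ true
    precedes-total i j with ℤP.<-cmp (densityExp A i) (densityExp A j)
    ... | tri< l _ _ = trans (cong (prec i j ∨_) (>⇒precedes j i l)) (∨-zeroʳ _)
    ... | tri> _ _ g = cong (_∨ prec j i) (>⇒precedes i j g)
    ... | tri≈ _ e _ with ℕP.≤-total (toℕ i) (toℕ j)
    ...   | inj₁ i≤j = cong (_∨ prec j i) (tie⇒precedes i j (sym e) i≤j)
    ...   | inj₂ j≤i = trans (cong (prec i j ∨_) (tie⇒precedes j i e j≤i)) (∨-zeroʳ _)

    w≥0 : ∀ j → 0ℚ ≤ w j
    w≥0 j = qpow-nonneg (weightExp A j)

    p≥0 : ∀ j → 0ℚ ≤ p j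
    p≥0 j = qpow-nonneg (sizeExp A j)

    σ≥0 : ∀ μ → 0ℚ ≤ σ μ
    σ≥0 μ = qpow-nonneg (ℤ.- speedExp A μ)

    delay : Assignment n m → Fin n → Fin n → ℚ
    delay a j i = ind (⌊ a i Fin.≟ a j ⌋ ∧ prec i j) (σ (a j) * (w j * p i))

    delay≥0 : ∀ a j i → 0ℚ ≤ delay a j i
    delay≥0 a j i = ind-nonneg _ (mul-nonneg (σ≥0 (a j)) (mul-nonneg (w≥0 j) (p≥0 i)))

    cost-as-delays : ∀ P a → cost k A P a ≡ ΣΣ jobs (λ j i → ind (P j ∧ P i) (delay a j i))
    cost-as-delays P a = Σl-cong jobs perJob
      where
      perJob : ∀ j → ind (P j) (w j * completion k A P a j) ≡ Σl jobs (λ i → ind (P j ∧ P i) (delay a j i))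
      perJob j with P j
      ... | false = sym (Σl-zero jobs (λ _ → refl))
      ... | true  = trans (cong (w j *_) (Σl-* jobs (σ (a j)) _)) (trans (Σl-* jobs (w j) _) (Σl-cong jobs perPair))
        where
        perPair : ∀ i → w j * (σ (a j) * ind (P i ∧ ⌊ a i Fin.≟ a j ⌋ ∧ prec i j) (p i)) ≡ ind (P i) (delay a j i)
        perPair i with P i | ⌊ a i Fin.≟ a j ⌋ ∧ prec i j
        ... | false | _     = trans (cong (w j *_) (ℚP.*-zeroʳ (σ (a j)))) (ℚP.*-zeroʳ (w j))
        ... | true  | false = trans (cong (w j *_) (ℚP.*-zeroʳ (σ (a j)))) (ℚP.*-zeroʳ (w j))
        ... | true  | true  = trans (sym (ℚP.*-assoc (w j) (σ (a j)) (p i)))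
                                (trans (cong (_* p i) (ℚP.*-comm (w j) (σ (a j)))) (ℚP.*-assoc (σ (a j)) (w j) (p i)))

    cost-nonneg : ∀ P a → 0ℚ ≤ cost k A P a
    cost-nonneg P a = subst (0ℚ ≤_) (sym (cost-as-delays P a))
      (ΣΣ-nonneg jobs (λ j i → ind-nonneg (P j ∧ P i) (delay≥0 a j i)))

    cost-empty : ∀ P a → (∀ j → P j ≡ false) → cost k A P a ≡ 0ℚ
    cost-empty P a none = trans (cost-as-delays P a)
      (Σl-zero jobs (λ j → Σl-zero jobs (λ i → ind-false (P j ∧ P i) (λ e → false≢true (trans (sym (none j)) (∧-proj₁ (P j) e))))))
      where
      false≢true : false ≡ true → ⊥
      false≢true ()

    cost-cong : ∀ P (s s' : Assignment n m) → (∀ j → P j ≡ true → s j ≡ s' j) → cost k A P s ≡ cost k A P s'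
    cost-cong P s s' agree = begin
      cost k A P s ≡⟨ cost-as-delays P s ⟩
      ΣΣ jobs (λ j i → ind (P j ∧ P i) (delay s j i))  ≡⟨ ΣΣ-cong jobs pair ⟩
      ΣΣ jobs (λ j i → ind (P j ∧ P i) (delay s' j i)) ≡⟨ sym (cost-as-delays P s') ⟩
      cost k A P s' ∎
      where
      open ≡-Reasoning
      pair : ∀ j i → ind (P j ∧ P i) (delay s j i) ≡ ind (P j ∧ P i) (delay s' j i)
      pair j i with P j in ej | P i in ei
      ... | true  | true  = cong₂ (λ μ μ' → ind (⌊ μ' Fin.≟ μ ⌋ ∧ prec i j) (σ μ * (w j * p i))) (agree j ej) (agree i ei)
      ... | true  | false = refl
      ... | false | _     = refl

    OPT-≤ : ∀ P s → OPT k A P ≤ cost k A P s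
    OPT-≤ P s with allAssignments-complete n m s
    ... | f , f∈ , f≗ = ℚP.≤-trans (foldr-⊓-≤ _ (allAssignments n m) (cost k A P) f∈)
                                     (ℚP.≤-reflexive (cost-cong P f s (λ j _ → f≗ j)))

    OPT-attained : ∀ P → Σ (Assignment n m) λ o → OPT k A P ≡ cost k A P o
    OPT-attained P = foldr-⊓-attained (λ _ → zero) (allAssignments n m) (cost k A P)

    onMachine : Assignment n m → Fin (suc m) → Fin n → Bool
    onMachine a μ j = ⌊ a j Fin.≟ μ ⌋

    split-machines : ∀ (a : Assignment n m) (d : Fin n → Fin n → Bool) →
      ΣΣ jobs (λ j i → ind (⌊ a i Fin.≟ a j ⌋ ∧ d j i) (σ (a j) * (w j * p i)))
      ≡ Σl machines (λ μ → σ μ * ΣΣ jobs (λ j i → ind (onMachine a μ j ∧ onMachine a μ i ∧ d j i) (w j * p i)))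
    split-machines a d = sym (begin
      Σl machines (λ μ → σ μ * ΣΣ jobs (λ j i → ind (onMachine a μ j ∧ onMachine a μ i ∧ d j i) (w j * p i)))
        ≡⟨ Σl-cong machines (λ μ → ΣΣ-* jobs (σ μ) _) ⟩
      Σl machines (λ μ → ΣΣ jobs (λ j i → σ μ * ind (onMachine a μ j ∧ onMachine a μ i ∧ d j i) (w j * p i)))
        ≡⟨ Σl-ΣΣ machines jobs _ ⟩
      ΣΣ jobs (λ j i → Σl machines (λ μ → σ μ * ind (onMachine a μ j ∧ onMachine a μ i ∧ d j i) (w j * p i)))
        ≡⟨ ΣΣ-cong jobs pickMachine ⟩
      ΣΣ jobs (λ j i → ind (⌊ a i Fin.≟ a j ⌋ ∧ d j i) (σ (a j) * (w j * p i))) ∎)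
      where
      open ≡-Reasoning
      -- only the machine μ = a j contributes
      pickMachine : ∀ j i → Σl machines (λ μ → σ μ * ind (onMachine a μ j ∧ onMachine a μ i ∧ d j i) (w j * p i))
                            ≡ ind (⌊ a i Fin.≟ a j ⌋ ∧ d j i) (σ (a j) * (w j * p i))
      pickMachine j i =
        trans (Σl-cong machines (λ μ → trans (ind-*ˡ (onMachine a μ j ∧ onMachine a μ i ∧ d j i) (σ μ) _)
                                             (ind-∧ (onMachine a μ j) _ _)))
              (allFin-select (suc m) (a j) (λ μ → ind (onMachine a μ i ∧ d j i) (σ μ * (w j * p i))))


module CrossTerm where

  open FiniteSums
  open RationalFacts
  open import Data.Nat using (ℕ)
  open import Data.Integer as ℤ using (ℤ)
  open import Data.Rational using (ℚ; 0ℚ; 1ℚ; _+_; _*_; _≤_; _<_)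
  import Data.Rational.Properties as ℚP
  open import Data.List using (List; allFin)
  open import Data.Bool using (Bool; true; false; _∧_; _∨_)
  open import Data.Fin using (Fin)
  open import Data.Product using (_×_; _,_)
  open import Relation.Nullary.Decidable using (⌊_⌋)
  open import Relation.Binary.PropositionalEquality
  open import Data.Rational.Solver
  open +-*-Solver

  symmetric-split : ∀ {A : Set} (xs : List A) (prec : A → A → Bool) →
    (∀ i j → prec i j ∨ prec j i ≡ true) →
    (f : A → A → ℚ) → (∀ j i → 0ℚ ≤ f j i) → (∀ j i → f j i ≡ f i j) →
    ΣΣ xs f ≤ ΣΣ xs (λ j i → ind (prec i j) (f j i)) + ΣΣ xs (λ j i → ind (prec i j) (f j i))
  symmetric-split xs prec total f f≥0 f-sym = begin
    ΣΣ xs f                                                      ≤⟨ ΣΣ-mono xs cover ⟩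
    ΣΣ xs (λ j i → ind (prec i j) (f j i) + ind (prec j i) (f j i)) ≡⟨ ΣΣ-+ xs _ _ ⟩
    ordered + ΣΣ xs (λ j i → ind (prec j i) (f j i))              ≡⟨ cong (ordered +_) transpose ⟩
    ordered + ordered ∎
    where
    open ℚP.≤-Reasoning
    ordered = ΣΣ xs (λ j i → ind (prec i j) (f j i))
    -- each pair is ordered at least one way
    cover : ∀ j i → f j i ≤ ind (prec i j) (f j i) + ind (prec j i) (f j i)
    cover j i with prec i j | prec j i | total i j
    ... | true  | true  | _ = ≤-by (f j i) (f≥0 j i) refl
    ... | true  | false | _ = ℚP.≤-reflexive (sym (ℚP.+-identityʳ _))
    ... | false | true  | _ = ℚP.≤-reflexive (sym (ℚP.+-identityˡ _))
    transpose : ΣΣ xs (λ j i → ind (prec j i) (f j i)) ≡ ordered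
    transpose = trans (Σl-swap xs xs (λ j i → ind (prec j i) (f j i)))
                      (ΣΣ-cong xs (λ j i → cong (ind (prec i j)) (f-sym i j)))

  -- Then the cost of the pairs of jobs from
  -- different blocks (cross cost X) is at most (2ε + ε²) times the total
  -- cost T: writing W v for the weight of block v and P v for the size of the
  -- later blocks, X = Σ_v W v · P v, and AM–GM splits each term into a part
  -- controlled by the cost inside block v and a part Σ_v D(v+1) P v², which
  -- the geometric growth of D bounds by 4T.
  module CrossTermBound
    {n : ℕ} (p w : Fin n → ℚ) (prec : Fin n → Fin n → Bool) (blk : Fin n → ℤ)
    (blocks : List ℤ) (D U : ℤ → ℚ) (κ ε : ℚ)
    (p≥0 : ∀ j → 0ℚ ≤ p j) (w≥0 : ∀ j → 0ℚ ≤ w j)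
    (prec-total : ∀ i j → prec i j ∨ prec j i ≡ true)
    (density-lower : ∀ j → p j * D (blk j) ≤ w j)
    (density-upper : ∀ j → w j ≤ U (blk j) * p j)
    (U≥0 : ∀ v → 0ℚ ≤ U v) (D>0 : ∀ v → 0ℚ < D v)
    (separation : ∀ v → U v * (κ * κ * κ) ≤ D (ℤ.suc v))
    (geometric : ∀ b → Σl blocks (λ v → ind ⌊ v ℤ.<? b ⌋ (D (ℤ.suc v))) ≤ D b + D b)
    (select-block : ∀ j (g : ℤ → ℚ) → Σl blocks (λ v → ind ⌊ v ℤ.≟ blk j ⌋ (g v)) ≡ g (blk j))
    (κε≡1 : κ * ε ≡ 1ℚ) (κ≥0 : 0ℚ ≤ κ) (ε≥0 : 0ℚ ≤ ε)
    (E : Fin n → Bool)  -- the jobs on the machine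
    where

    jobs : List (Fin n)
    jobs = allFin n

    wp≥0 : ∀ j i → 0ℚ ≤ w j * p i
    wp≥0 j i = mul-nonneg (w≥0 j) (p≥0 i)

    -- T: total cost of the machine (up to its speed); X: its cross-block part
    total-cost cross-cost : ℚ
    total-cost = ΣΣ jobs (λ j i → ind (E j ∧ E i ∧ prec i j) (w j * p i))
    cross-cost = ΣΣ jobs (λ j i → ind (E j ∧ E i ∧ ⌊ blk j ℤ.<? blk i ⌋) (w j * p i))

    inBlock above : ℤ → Fin n → Bool
    inBlock v j = E j ∧ ⌊ v ℤ.≟ blk j ⌋
    above   v i = E i ∧ ⌊ v ℤ.<? blk i ⌋

    blockWeight sizeAbove blockCost : ℤ → ℚ
    blockWeight v = Σl jobs (λ j → ind (inBlock v j) (w j))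
    sizeAbove   v = Σl jobs (λ i → ind (above v i) (p i))
    blockCost   v = ΣΣ jobs (λ j i → ind (inBlock v j ∧ inBlock v i ∧ prec i j) (w j * p i))

    blockCost≥0 : ∀ v → 0ℚ ≤ blockCost v
    blockCost≥0 v = ΣΣ-nonneg jobs (λ j i → ind-nonneg _ (wp≥0 j i))

    cross-cost-by-blocks : cross-cost ≡ Σl blocks (λ v → blockWeight v * sizeAbove v)
    cross-cost-by-blocks = sym (begin
      Σl blocks (λ v → blockWeight v * sizeAbove v)
        ≡⟨ Σl-cong blocks (λ v → Σl-product jobs jobs _ _) ⟩
      Σl blocks (λ v → ΣΣ jobs (λ j i → ind (inBlock v j) (w j) * ind (above v i) (p i)))
        ≡⟨ Σl-ΣΣ blocks jobs _ ⟩
      ΣΣ jobs (λ j i → Σl blocks (λ v → ind (inBlock v j) (w j) * ind (above v i) (p i)))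
        ≡⟨ ΣΣ-cong jobs pair ⟩
      cross-cost ∎)
      where
      open ≡-Reasoning
      pair : ∀ j i → Σl blocks (λ v → ind (inBlock v j) (w j) * ind (above v i) (p i))
                     ≡ ind (E j ∧ E i ∧ ⌊ blk j ℤ.<? blk i ⌋) (w j * p i)
      pair j i = trans (Σl-cong blocks factor)
                   (trans (select-block j (λ v → ind (E j) (w j) * ind (above v i) (p i)))
                          (ind-product (E j) (E i ∧ ⌊ blk j ℤ.<? blk i ⌋) _ _))
        where
        factor : ∀ v → ind (inBlock v j) (w j) * ind (above v i) (p i)
                       ≡ ind ⌊ v ℤ.≟ blk j ⌋ (ind (E j) (w j) * ind (above v i) (p i))
        factor v with E j | ⌊ v ℤ.≟ blk j ⌋
        ... | true  | true  = refl
        ... | true  | false = ℚP.*-zeroˡ (ind (above v i) (p i))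
        ... | false | true  = refl
        ... | false | false = ℚP.*-zeroˡ (ind (above v i) (p i))

    -- W v² ≤ 2 U v · (cost inside block v): w j w i ≤ U v · w j p i in block v
    blockWeight² : ∀ v → blockWeight v * blockWeight v ≤ U v * blockCost v + U v * blockCost v
    blockWeight² v = begin
      blockWeight v * blockWeight v ≡⟨ Σl-product jobs jobs _ _ ⟩
      ΣΣ jobs f                      ≤⟨ symmetric-split jobs prec prec-total f f≥0 f-sym ⟩
      ordered + ordered              ≤⟨ ℚP.+-mono-≤ ordered≤ ordered≤ ⟩
      U v * blockCost v + U v * blockCost v ∎
      where
      open ℚP.≤-Reasoning
      f : Fin n → Fin n → ℚ
      f j i = ind (inBlock v j) (w j) * ind (inBlock v i) (w i)
      f≥0 : ∀ j i → 0ℚ ≤ f j i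
      f≥0 j i = mul-nonneg (ind-nonneg (inBlock v j) (w≥0 j)) (ind-nonneg (inBlock v i) (w≥0 i))
      f-sym : ∀ j i → f j i ≡ f i j
      f-sym j i = ℚP.*-comm (ind (inBlock v j) (w j)) (ind (inBlock v i) (w i))
      ordered = ΣΣ jobs (λ j i → ind (prec i j) (f j i))
      pair : ∀ j i → ind (prec i j) (f j i) ≤ U v * ind (inBlock v j ∧ inBlock v i ∧ prec i j) (w j * p i)
      pair j i = begin
        ind (prec i j) (f j i)
          ≡⟨ cong (ind (prec i j)) (ind-product (inBlock v j) (inBlock v i) (w j) (w i)) ⟩
        ind (prec i j) (ind (inBlock v j ∧ inBlock v i) (w j * w i))
          ≡⟨ sym (ind-∧ (prec i j) _ _) ⟩
        ind (prec i j ∧ (inBlock v j ∧ inBlock v i)) (w j * w i)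
          ≤⟨ ind-≤-ind (prec i j ∧ (inBlock v j ∧ inBlock v i)) (inBlock v j ∧ inBlock v i ∧ prec i j)
               both (mul-nonneg (U≥0 v) (wp≥0 j i)) ⟩
        ind (inBlock v j ∧ inBlock v i ∧ prec i j) (U v * (w j * p i))
          ≡⟨ sym (ind-*ˡ _ (U v) _) ⟩
        U v * ind (inBlock v j ∧ inBlock v i ∧ prec i j) (w j * p i) ∎
        where
        both : prec i j ∧ (inBlock v j ∧ inBlock v i) ≡ true →
               (inBlock v j ∧ inBlock v i ∧ prec i j ≡ true) × (w j * w i ≤ U v * (w j * p i))
        both e = ∧-intro j∈v (∧-intro i∈v i≺j) , weights
          where
          i≺j = ∧-proj₁ (prec i j) e
          j∈v = ∧-proj₁ (inBlock v j) (∧-proj₂ (prec i j) e)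
          i∈v = ∧-proj₂ (inBlock v j) (∧-proj₂ (prec i j) e)
          v≡blk-i : v ≡ blk i
          v≡blk-i = witness (v ℤ.≟ blk i) (∧-proj₂ (E i) i∈v)
          weights : w j * w i ≤ U v * (w j * p i)
          weights = begin
            w j * w i               ≤⟨ *-monoˡ (w j) (w≥0 j) (density-upper i) ⟩
            w j * (U (blk i) * p i) ≡⟨ cong (λ u → w j * (U u * p i)) (sym v≡blk-i) ⟩
            w j * (U v * p i)       ≡⟨ solve 3 (λ a b c → a :* (b :* c) := b :* (a :* c)) refl (w j) (U v) (p i) ⟩
            U v * (w j * p i) ∎
      ordered≤ : ordered ≤ U v * blockCost v
      ordered≤ = begin
        ordered ≤⟨ ΣΣ-mono jobs pair ⟩
        ΣΣ jobs (λ j i → U v * ind (inBlock v j ∧ inBlock v i ∧ prec i j) (w j * p i)) ≡⟨ sym (ΣΣ-* jobs (U v) _) ⟩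
        U v * blockCost v ∎

    Σ-blockCost : Σl blocks blockCost ≤ total-cost
    Σ-blockCost = begin
      Σl blocks blockCost
        ≤⟨ Σl-mono blocks (λ v → ΣΣ-mono jobs (pair v)) ⟩
      Σl blocks (λ v → ΣΣ jobs (λ j i → ind ⌊ v ℤ.≟ blk j ⌋ (t j i))) ≡⟨ Σl-ΣΣ blocks jobs _ ⟩
      ΣΣ jobs (λ j i → Σl blocks (λ v → ind ⌊ v ℤ.≟ blk j ⌋ (t j i)))  ≡⟨ ΣΣ-cong jobs (λ j i → select-block j (λ _ → t j i)) ⟩
      total-cost ∎
      where
      open ℚP.≤-Reasoning
      t : Fin n → Fin n → ℚ
      t j i = ind (E j ∧ E i ∧ prec i j) (w j * p i)
      pair : ∀ v j i → ind (inBlock v j ∧ inBlock v i ∧ prec i j) (w j * p i) ≤ ind ⌊ v ℤ.≟ blk j ⌋ (t j i)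
      pair v j i = subst (ind (inBlock v j ∧ inBlock v i ∧ prec i j) (w j * p i) ≤_)
        (ind-∧ ⌊ v ℤ.≟ blk j ⌋ (E j ∧ E i ∧ prec i j) (w j * p i))
        (ind-≤-ind (inBlock v j ∧ inBlock v i ∧ prec i j) (⌊ v ℤ.≟ blk j ⌋ ∧ (E j ∧ E i ∧ prec i j)) forget (wp≥0 j i))
        where
        forget : inBlock v j ∧ inBlock v i ∧ prec i j ≡ true →
                 (⌊ v ℤ.≟ blk j ⌋ ∧ (E j ∧ E i ∧ prec i j) ≡ true) × (w j * p i ≤ w j * p i)
        forget e = ∧-intro (∧-proj₂ (E j) j∈v) (∧-intro (∧-proj₁ (E j) j∈v) (∧-intro (∧-proj₁ (E i) i∈v) i≺j)) , ℚP.≤-refl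
          where
          j∈v = ∧-proj₁ (inBlock v j) e
          i∈v = ∧-proj₁ (inBlock v i) (∧-proj₂ (inBlock v j) e)
          i≺j = ∧-proj₂ (inBlock v i) (∧-proj₂ (inBlock v j) e)

    ordered : Fin n → Fin n → Bool
    ordered j i = E j ∧ E i ∧ prec i j

    orderedAbove : ℤ → ℚ
    orderedAbove v = ΣΣ jobs (λ j i → ind (prec i j) (ind (above v j) (p j) * ind (above v i) (p i)))

    sizeAbove² : ∀ v → D (ℤ.suc v) * (sizeAbove v * sizeAbove v)
                       ≤ D (ℤ.suc v) * orderedAbove v + D (ℤ.suc v) * orderedAbove v
    sizeAbove² v = begin
      D (ℤ.suc v) * (sizeAbove v * sizeAbove v)
        ≡⟨ cong (D (ℤ.suc v) *_) (Σl-product jobs jobs _ _) ⟩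
      D (ℤ.suc v) * ΣΣ jobs (λ j i → ind (above v j) (p j) * ind (above v i) (p i))
        ≤⟨ *-monoˡ (D (ℤ.suc v)) (ℚP.<⇒≤ (D>0 _))
             (symmetric-split jobs prec prec-total _
                (λ j i → mul-nonneg (ind-nonneg (above v j) (p≥0 j)) (ind-nonneg (above v i) (p≥0 i)))
                (λ j i → ℚP.*-comm (ind (above v j) (p j)) (ind (above v i) (p i)))) ⟩
      D (ℤ.suc v) * (orderedAbove v + orderedAbove v)
        ≡⟨ ℚP.*-distribˡ-+ (D (ℤ.suc v)) (orderedAbove v) (orderedAbove v) ⟩
      D (ℤ.suc v) * orderedAbove v + D (ℤ.suc v) * orderedAbove v ∎
      where open ℚP.≤-Reasoning

    charge : ∀ v j i → D (ℤ.suc v) * ind (prec i j) (ind (above v j) (p j) * ind (above v i) (p i))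
                       ≤ ind (ordered j i) (p j * p i) * ind ⌊ v ℤ.<? blk j ⌋ (D (ℤ.suc v))
    charge v j i = begin
      D (ℤ.suc v) * ind (prec i j) (ind (above v j) (p j) * ind (above v i) (p i))
        ≡⟨ cong (λ x → D (ℤ.suc v) * ind (prec i j) x) (ind-product (above v j) (above v i) (p j) (p i)) ⟩
      D (ℤ.suc v) * ind (prec i j) (ind (above v j ∧ above v i) (p j * p i))
        ≡⟨ cong (D (ℤ.suc v) *_) (sym (ind-∧ (prec i j) (above v j ∧ above v i) (p j * p i))) ⟩
      D (ℤ.suc v) * ind (prec i j ∧ (above v j ∧ above v i)) (p j * p i)
        ≡⟨ ind-*ˡ (prec i j ∧ (above v j ∧ above v i)) (D (ℤ.suc v)) (p j * p i) ⟩
      ind (prec i j ∧ (above v j ∧ above v i)) (D (ℤ.suc v) * (p j * p i))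
        ≤⟨ ind-≤-ind (prec i j ∧ (above v j ∧ above v i)) (ordered j i ∧ ⌊ v ℤ.<? blk j ⌋) regroup
             (mul-nonneg (mul-nonneg (p≥0 j) (p≥0 i)) (ℚP.<⇒≤ (D>0 _))) ⟩
      ind (ordered j i ∧ ⌊ v ℤ.<? blk j ⌋) (p j * p i * D (ℤ.suc v))
        ≡⟨ sym (ind-product (ordered j i) ⌊ v ℤ.<? blk j ⌋ (p j * p i) (D (ℤ.suc v))) ⟩
      ind (ordered j i) (p j * p i) * ind ⌊ v ℤ.<? blk j ⌋ (D (ℤ.suc v)) ∎
      where
      open ℚP.≤-Reasoning
      regroup : prec i j ∧ (above v j ∧ above v i) ≡ true →
                (ordered j i ∧ ⌊ v ℤ.<? blk j ⌋ ≡ true) × (D (ℤ.suc v) * (p j * p i) ≤ p j * p i * D (ℤ.suc v))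
      regroup e = ∧-intro (∧-intro (∧-proj₁ (E j) j>v) (∧-intro (∧-proj₁ (E i) i>v) i≺j)) (∧-proj₂ (E j) j>v)
                , ℚP.≤-reflexive (ℚP.*-comm (D (ℤ.suc v)) (p j * p i))
        where
        i≺j = ∧-proj₁ (prec i j) e
        j>v = ∧-proj₁ (above v j) (∧-proj₂ (prec i j) e)
        i>v = ∧-proj₂ (above v j) (∧-proj₂ (prec i j) e)

    -- summed over v, the charges of an ordered pair are at most 2 w j p i:
    -- Σ_{v < blk j} D(v+1) ≤ 2 D(blk j) and p j D(blk j) ≤ w j
    Σ-charge : ∀ j i → Σl blocks (λ v → D (ℤ.suc v) * ind (prec i j) (ind (above v j) (p j) * ind (above v i) (p i)))
                       ≤ ind (ordered j i) (w j * p i) + ind (ordered j i) (w j * p i)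
    Σ-charge j i = begin
      Σl blocks (λ v → D (ℤ.suc v) * ind (prec i j) (ind (above v j) (p j) * ind (above v i) (p i)))
        ≤⟨ Σl-mono blocks (λ v → charge v j i) ⟩
      Σl blocks (λ v → ind (ordered j i) (p j * p i) * ind ⌊ v ℤ.<? blk j ⌋ (D (ℤ.suc v)))
        ≡⟨ sym (Σl-* blocks (ind (ordered j i) (p j * p i)) _) ⟩
      ind (ordered j i) (p j * p i) * Σl blocks (λ v → ind ⌊ v ℤ.<? blk j ⌋ (D (ℤ.suc v)))
        ≤⟨ *-monoˡ _ (ind-nonneg (ordered j i) (mul-nonneg (p≥0 j) (p≥0 i))) (geometric (blk j)) ⟩
      ind (ordered j i) (p j * p i) * (D (blk j) + D (blk j))
        ≡⟨ ind-*ʳ (ordered j i) _ _ ⟩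
      ind (ordered j i) (p j * p i * (D (blk j) + D (blk j)))
        ≤⟨ ind-mono (ordered j i) bound ⟩
      ind (ordered j i) (w j * p i + w j * p i)
        ≡⟨ ind-+ (ordered j i) _ _ ⟩
      ind (ordered j i) (w j * p i) + ind (ordered j i) (w j * p i) ∎
      where
      open ℚP.≤-Reasoning
      bound : p j * p i * (D (blk j) + D (blk j)) ≤ w j * p i + w j * p i
      bound = begin
        p j * p i * (D (blk j) + D (blk j))
          ≡⟨ solve 3 (λ a b d → a :* b :* (d :+ d) := a :* d :* b :+ a :* d :* b) refl (p j) (p i) (D (blk j)) ⟩
        p j * D (blk j) * p i + p j * D (blk j) * p i
          ≤⟨ ℚP.+-mono-≤ (*-monoʳ (p i) (p≥0 i) (density-lower j)) (*-monoʳ (p i) (p≥0 i) (density-lower j)) ⟩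
        w j * p i + w j * p i ∎

    Σ-sizeAbove² : Σl blocks (λ v → D (ℤ.suc v) * (sizeAbove v * sizeAbove v))
                   ≤ (total-cost + total-cost) + (total-cost + total-cost)
    Σ-sizeAbove² = begin
      Σl blocks (λ v → D (ℤ.suc v) * (sizeAbove v * sizeAbove v)) ≤⟨ Σl-mono blocks sizeAbove² ⟩
      Σl blocks (λ v → D (ℤ.suc v) * orderedAbove v + D (ℤ.suc v) * orderedAbove v) ≡⟨ Σl-+ blocks _ _ ⟩
      half + half ≤⟨ ℚP.+-mono-≤ half≤ half≤ ⟩
      (total-cost + total-cost) + (total-cost + total-cost) ∎
      where
      open ℚP.≤-Reasoning
      half = Σl blocks (λ v → D (ℤ.suc v) * orderedAbove v)
      half≤ : half ≤ total-cost + total-cost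
      half≤ = begin
        half ≡⟨ Σl-cong blocks (λ v → ΣΣ-* jobs (D (ℤ.suc v)) _) ⟩
        Σl blocks (λ v → ΣΣ jobs (λ j i → D (ℤ.suc v) * ind (prec i j) (ind (above v j) (p j) * ind (above v i) (p i))))
          ≡⟨ Σl-ΣΣ blocks jobs _ ⟩
        ΣΣ jobs (λ j i → Σl blocks (λ v → D (ℤ.suc v) * ind (prec i j) (ind (above v j) (p j) * ind (above v i) (p i))))
          ≤⟨ ΣΣ-mono jobs Σ-charge ⟩
        ΣΣ jobs (λ j i → ind (ordered j i) (w j * p i) + ind (ordered j i) (w j * p i)) ≡⟨ ΣΣ-+ jobs _ _ ⟩
        total-cost + total-cost ∎

    α : ℚ
    α = (ε + ε) + ε * ε

    cross-cost-bound : cross-cost ≤ α * total-cost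
    cross-cost-bound = halve (begin
      cross-cost + cross-cost ≡⟨ cong₂ _+_ cross-cost-by-blocks cross-cost-by-blocks ⟩
      Σl blocks (λ v → W v * P v) + Σl blocks (λ v → W v * P v) ≡⟨ sym (Σl-+ blocks _ _) ⟩
      Σl blocks (λ v → W v * P v + W v * P v)
        ≤⟨ Σl-mono blocks (λ v → block-am-gm {P = P v} {W = W v} {U = U v} κε≡1 κ≥0 ε≥0 (D>0 _) (blockCost≥0 v) (blockWeight² v) (separation v)) ⟩
      Σl blocks (λ v → ε * (D (ℤ.suc v) * (P v * P v)) + (ε * ε) * (blockCost v + blockCost v))
        ≡⟨ trans (Σl-+ blocks _ _) (cong₂ _+_ (sym (Σl-* blocks ε _))
             (trans (sym (Σl-* blocks (ε * ε) _)) (cong ((ε * ε) *_) (Σl-+ blocks blockCost blockCost)))) ⟩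
      ε * Σl blocks (λ v → D (ℤ.suc v) * (P v * P v)) + (ε * ε) * (Σl blocks blockCost + Σl blocks blockCost)
        ≤⟨ ℚP.+-mono-≤ (*-monoˡ ε ε≥0 Σ-sizeAbove²)
                       (*-monoˡ (ε * ε) (mul-nonneg ε≥0 ε≥0) (ℚP.+-mono-≤ Σ-blockCost Σ-blockCost)) ⟩
      ε * ((T + T) + (T + T)) + (ε * ε) * (T + T)
        ≡⟨ solve 2 (λ ε T → ε :* ((T :+ T) :+ (T :+ T)) :+ (ε :* ε) :* (T :+ T)
                          := ((ε :+ ε) :+ ε :* ε) :* T :+ ((ε :+ ε) :+ ε :* ε) :* T) refl ε T ⟩
      α * T + α * T ∎)
      where
      open ℚP.≤-Reasoning
      W = blockWeight
      P = sizeAbove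
      T = total-cost


module DensityBlocks where

  open import Defs
  open FiniteSums using (decide-true)
  open import Data.Nat as ℕ using (ℕ; suc; NonZero)
  import Data.Nat.Properties as ℕP
  open import Data.Integer as ℤ using (ℤ; +_; _+_; _*_; _-_)
  import Data.Integer.Properties as ℤP
  open import Data.Integer.DivMod using (_/ℕ_; [n/ℕd]*d≤n; n<s[n/ℕd]*d)
  open import Data.Bool using (_∧_)
  open import Data.Fin using (Fin)
  open import Data.Product using (_,_)
  open import Data.Empty using (⊥-elim)
  open import Relation.Nullary using (¬_)
  open import Relation.Nullary.Decidable using (⌊_⌋; yes; no)
  open import Relation.Binary using (tri<; tri≈; tri>)
  open import Relation.Binary.PropositionalEquality
  open import Data.Integer.Solver
  open +-*-Solver

  sub-add : ∀ a b → (a - b) + b ≡ a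
  sub-add a b = solve 2 (λ a b → (a :- b) :+ b := a) refl a b

  add-sub : ∀ a b → a + (b - a) ≡ b
  add-sub a b = solve 2 (λ a b → a :+ (b :- a) := b) refl a b

  range-width : ∀ y → ℤ.- y + (+ 1 + (y + y)) ≡ + 1 + y
  range-width y = solve 1 (λ y → :- y :+ (con (+ 1) :+ (y :+ y)) := con (+ 1) :+ y) refl y

  -- Block v consists of the
  -- exponents in [Lo v, Up v]; the exponents in (Up v, Lo (v+1)) form the gap
  -- of ξ values that no job uses.  Consecutive blocks start M = Kξ apart,
  -- with K = k^(ℓ+1), so every job lies in exactly one block blk j, and
  -- blockJobs v is the set of jobs j with blk j = v.
  module Blocks (k' ℓ ξ ζ : ℕ) {n m : ℕ} (A : Instance n m) (ξ≥1 : 1 ℕ.≤ ξ)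
    (no-gap-job : ∀ (j : Fin n) (v : ℤ) → ¬ inGap (suc k') ℓ ξ ζ v (densityExp A j)) where

    K M : ℕ
    K = suc k' ℕ.^ (ℓ ℕ.+ 1)
    M = K ℕ.* ξ

    K≥1 : 1 ℕ.≤ K
    K≥1 = ℕP.m^n>0 (suc k') (ℓ ℕ.+ 1)

    instance
      M≢0 : NonZero M
      M≢0 = ℕP.m*n≢0 K ξ {{ℕ.>-nonZero K≥1}} {{ℕ.>-nonZero ξ≥1}}

    ξ≤M : ξ ℕ.≤ M
    ξ≤M = subst (ℕ._≤ M) (ℕP.*-identityˡ ξ) (ℕP.*-monoˡ-≤ ξ K≥1)

    Lo Up : ℤ → ℤ
    Lo v = (v * + K + + ζ + + 1) * + ξ + + 1
    Up v = ((v + + 1) * + K + + ζ) * + ξ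

    Lo-step : ∀ v → Lo v ≡ v * + M + Lo (+ 0)
    Lo-step v = trans (solve 4 (λ v K Z X → (v :* K :+ Z :+ con (+ 1)) :* X :+ con (+ 1)
                                  := v :* (K :* X) :+ ((con (+ 0) :* K :+ Z :+ con (+ 1)) :* X :+ con (+ 1)))
                           refl v (+ K) (+ ζ) (+ ξ))
                      (cong (λ x → v * x + Lo (+ 0)) (sym (ℤP.pos-* K ξ)))

    Lo-suc : ∀ v → Lo (ℤ.suc v) ≡ Lo v + + M
    Lo-suc v = trans (solve 4 (λ v K Z X → ((con (+ 1) :+ v) :* K :+ Z :+ con (+ 1)) :* X :+ con (+ 1)
                                 := (v :* K :+ Z :+ con (+ 1)) :* X :+ con (+ 1) :+ K :* X)
                          refl v (+ K) (+ ζ) (+ ξ))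
                     (cong (λ x → Lo v + x) (sym (ℤP.pos-* K ξ)))

    Lo-after-Up : ∀ v → Lo (ℤ.suc v) ≡ Up v + (+ ξ + + 1)
    Lo-after-Up v = solve 4 (λ v K Z X → ((con (+ 1) :+ v) :* K :+ Z :+ con (+ 1)) :* X :+ con (+ 1)
                                    := ((v :+ con (+ 1)) :* K :+ Z) :* X :+ (X :+ con (+ 1)))
                            refl v (+ K) (+ ζ) (+ ξ)

    Up<Lo-suc : ∀ v → Up v ℤ.< Lo (ℤ.suc v)
    Up<Lo-suc v = subst (Up v ℤ.<_) (sym (Lo-after-Up v))
      (subst (ℤ._< Up v + (+ ξ + + 1)) (ℤP.+-identityʳ (Up v))
             (ℤP.+-monoʳ-< (Up v) (ℤ.+<+ (subst (0 ℕ.<_) (ℕP.+-comm 1 ξ) (ℕ.s≤s ℕ.z≤n)))))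

    Lo-mono : ∀ {u v} → u ℤ.≤ v → Lo u ℤ.≤ Lo v
    Lo-mono {u} {v} h = subst₂ ℤ._≤_ (sym (Lo-step u)) (sym (Lo-step v))
      (ℤP.+-monoˡ-≤ (Lo (+ 0)) (ℤP.*-monoʳ-≤-nonNeg (+ M) h))

    β : Fin n → ℤ
    β = densityExp A

    -- the block of a job, by division with remainder; kept abstract so that
    -- it is only used through the two inequalities characterising it
    abstract
      blk : Fin n → ℤ
      blk j = (β j - Lo (+ 0)) /ℕ M

      Lo≤β : ∀ j → Lo (blk j) ℤ.≤ β j
      Lo≤β j = subst₂ ℤ._≤_ (sym (Lo-step (blk j))) (sub-add (β j) (Lo (+ 0)))
        (ℤP.+-monoˡ-≤ (Lo (+ 0)) ([n/ℕd]*d≤n (β j - Lo (+ 0)) M))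

      β<Lo-suc : ∀ j → β j ℤ.< Lo (ℤ.suc (blk j))
      β<Lo-suc j = subst₂ ℤ._<_ (sub-add (β j) (Lo (+ 0))) (sym (Lo-step (ℤ.suc (blk j))))
        (ℤP.+-monoˡ-< (Lo (+ 0)) (n<s[n/ℕd]*d (β j - Lo (+ 0)) M))

    -- the gap hypothesis excludes the rest of [Lo (blk j), Lo (blk j + 1))
    β≤Up : ∀ j → β j ℤ.≤ Up (blk j)
    β≤Up j with β j ℤ.≤? Up (blk j)
    ... | yes h = h
    ... | no ¬h = ⊥-elim (no-gap-job j (ℤ.suc (blk j)) (gap-start , gap-end))
      where
      v = blk j
      gap-start : ((ℤ.suc v * + K + + ζ) * + ξ) + + 1 ℤ.≤ β j
      gap-start = subst (ℤ._≤ β j)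
        (solve 4 (λ v K Z X → con (+ 1) :+ ((v :+ con (+ 1)) :* K :+ Z) :* X
                            := (((con (+ 1) :+ v) :* K :+ Z) :* X) :+ con (+ 1)) refl v (+ K) (+ ζ) (+ ξ))
        (ℤP.i<j⇒suc[i]≤j (ℤP.≰⇒> ¬h))
      gap-end : β j ℤ.≤ ((ℤ.suc v * + K + + ζ) + + 1) * + ξ
      gap-end = subst (β j ℤ.≤_) (ℤP.pred-suc _)
        (ℤP.i<j⇒i≤pred[j] (subst (β j ℤ.<_)
          (solve 4 (λ v K Z X → ((con (+ 1) :+ v) :* K :+ Z :+ con (+ 1)) :* X :+ con (+ 1)
                             := con (+ 1) :+ (((con (+ 1) :+ v) :* K :+ Z) :+ con (+ 1)) :* X) refl v (+ K) (+ ζ) (+ ξ))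
          (β<Lo-suc j)))

    block-unique : ∀ {u v b} → Lo u ℤ.≤ b → b ℤ.< Lo (ℤ.suc u) → Lo v ℤ.≤ b → b ℤ.< Lo (ℤ.suc v) → u ≡ v
    block-unique {u} {v} u≤b b<u' v≤b b<v' with ℤP.<-cmp u v
    ... | tri< u<v _ _ = ⊥-elim (ℤP.<-irrefl refl (ℤP.<-≤-trans b<u' (ℤP.≤-trans (Lo-mono (ℤP.i<j⇒suc[i]≤j u<v)) v≤b)))
    ... | tri≈ _ e _   = e
    ... | tri> _ _ v<u = ⊥-elim (ℤP.<-irrefl refl (ℤP.<-≤-trans b<v' (ℤP.≤-trans (Lo-mono (ℤP.i<j⇒suc[i]≤j v<u)) u≤b)))

    blockJobs≡ : ∀ v j → blockJobs (suc k') ℓ ξ ζ A v j ≡ ⌊ v ℤ.≟ blk j ⌋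
    blockJobs≡ v j with v ℤ.≟ blk j
    ... | yes refl = cong₂ _∧_ (decide-true (Lo v ℤ.≤? β j) (Lo≤β j)) (decide-true (β j ℤ.≤? Up v) (β≤Up j))
    ... | no v≢blk with Lo v ℤ.≤? β j | β j ℤ.≤? Up v
    ...   | yes lo | yes up = ⊥-elim (v≢blk (block-unique lo (ℤP.≤-<-trans up (Up<Lo-suc v)) (Lo≤β j) (β<Lo-suc j)))
    ...   | yes _  | no  _  = refl
    ...   | no  _  | _      = refl

    blk-mono : ∀ {i j} → β i ℤ.≤ β j → blk i ℤ.≤ blk j
    blk-mono {i} {j} h = ℤP.≮⇒≥ (λ j<i → ℤP.<-irrefl refl
      (ℤP.<-≤-trans (β<Lo-suc j) (ℤP.≤-trans (Lo-mono (ℤP.i<j⇒suc[i]≤j j<i)) (ℤP.≤-trans (Lo≤β i) h))))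


module BlockBounds where

  open import Defs
  open FiniteSums
  open RationalFacts
  open Powers
  open ScheduleCost
  open DensityBlocks
  open import Data.Nat as ℕ using (ℕ; zero; suc)
  import Data.Nat.Properties as ℕP
  open import Data.Nat.ListAction using (sum)
  open import Data.Integer as ℤ using (ℤ; +_; -[1+_])
  import Data.Integer.Properties as ℤP
  open import Data.Rational using (ℚ; 0ℚ; 1ℚ; _+_; _*_; _≤_; _<_; _/_)
  import Data.Rational.Properties as ℚP
  open import Data.List using (List; _∷_; map; allFin)
  open import Data.List.Relation.Unary.Any using (here; there)
  open import Data.List.Membership.Propositional using (_∈_)
  open import Data.List.Membership.Propositional.Properties using (∈-map⁺; ∈-allFin)
  open import Data.Fin using (Fin)
  open import Data.Product using (proj₁)
  open import Relation.Nullary using (¬_)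
  open import Relation.Nullary.Decidable using (⌊_⌋; yes; no)
  open import Relation.Binary.PropositionalEquality
  open import Data.Rational.Solver
  open +-*-Solver

  doubling-sum : (D : ℤ → ℚ) → (∀ u → 0ℚ ≤ D u) → (∀ {u v} → u ℤ.≤ v → D u ≤ D v) →
    (∀ u → D u + D u ≤ D (ℤ.suc u)) →
    ∀ N lo b → Σl (range lo N) (λ v → ind ⌊ v ℤ.<? b ⌋ (D (ℤ.suc v))) ≤ D b + D b
  doubling-sum D D≥0 D-mono doubling N lo b with lo ℤ.≤? b
  ... | yes lo≤b = ℚP.≤-trans (≤-by (D lo + D lo) (+-nonneg (D≥0 lo) (D≥0 lo)) refl) (telescope N lo lo≤b)
    where
    -- the invariant: the remaining sum plus 2 D lo stays below 2 D b
    telescope : ∀ N lo → lo ℤ.≤ b →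
      Σl (range lo N) (λ v → ind ⌊ v ℤ.<? b ⌋ (D (ℤ.suc v))) + (D lo + D lo) ≤ D b + D b
    telescope zero lo h = subst (_≤ D b + D b) (sym (ℚP.+-identityˡ _)) (ℚP.+-mono-≤ (D-mono h) (D-mono h))
    telescope (suc N) lo h with lo ℤ.<? b
    ... | yes lo<b = begin
      D (ℤ.suc lo) + rest + (D lo + D lo)   ≤⟨ ℚP.+-monoʳ-≤ (D (ℤ.suc lo) + rest) (doubling lo) ⟩
      D (ℤ.suc lo) + rest + D (ℤ.suc lo)
        ≡⟨ solve 2 (λ d s → d :+ s :+ d := s :+ (d :+ d)) refl (D (ℤ.suc lo)) rest ⟩
      rest + (D (ℤ.suc lo) + D (ℤ.suc lo)) ≤⟨ telescope N (ℤ.suc lo) (ℤP.i<j⇒suc[i]≤j lo<b) ⟩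
      D b + D b ∎
      where
      open ℚP.≤-Reasoning
      rest = Σl (range (ℤ.suc lo) N) (λ v → ind ⌊ v ℤ.<? b ⌋ (D (ℤ.suc v)))
    ... | no lo≮b = begin
      0ℚ + rest + (D lo + D lo)
        ≡⟨ cong (λ z → 0ℚ + z + (D lo + D lo)) (range-below N (ℤ.suc lo) b _ (ℤP.≤-trans (ℤP.≮⇒≥ lo≮b) (ℤP.i≤suc[i] lo))) ⟩
      0ℚ + 0ℚ + (D lo + D lo) ≡⟨ ℚP.+-identityˡ _ ⟩
      D lo + D lo             ≤⟨ ℚP.+-mono-≤ (D-mono h) (D-mono h) ⟩
      D b + D b ∎
      where
      open ℚP.≤-Reasoning
      rest = Σl (range (ℤ.suc lo) N) (λ v → ind ⌊ v ℤ.<? b ⌋ (D (ℤ.suc v)))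
  ... | no lo≰b = subst (_≤ D b + D b) (sym (range-below N lo b _ (ℤP.<⇒≤ (ℤP.≰⇒> lo≰b))))
                        (+-nonneg (D≥0 b) (D≥0 b))

  ∈⇒≤sum : ∀ {n} {ns : List ℕ} → n ∈ ns → n ℕ.≤ sum ns
  ∈⇒≤sum         (here refl) = ℕP.m≤m+n _ _
  ∈⇒≤sum {ns = m ∷ ns} (there h) = ℕP.≤-trans (∈⇒≤sum h) (ℕP.m≤n+m _ m)

  -- The hypotheses of CrossTermBound for the blocks of the theorem, with
  -- D v = (1+δ)^(Lo v), U v = (1+δ)^(Up v), κ = k = 1/δ and ε = δ.
  module Bounds (k' ℓ ξ ζ : ℕ) {n m : ℕ} (A : Instance n m)
    (3≤ℓ : 3 ℕ.≤ ℓ) (8≤k : 8 ℕ.≤ suc k') (isXi : IsXi (suc k') ℓ ξ)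
    (no-gap-job : ∀ (j : Fin n) (v : ℤ) → ¬ inGap (suc k') ℓ ξ ζ v (densityExp A j)) where

    open OnePlusδPowers k'
    open Schedules k' A using (w; p)

    κ ε : ℚ
    κ = fromℕ k
    ε = (+ 1) / k

    κε≡1 : κ * ε ≡ 1ℚ
    κε≡1 = /-inverse k' 0

    κ≥0 : 0ℚ ≤ κ
    κ≥0 = fromℕ-nonneg k

    ε≥0 : 0ℚ ≤ ε
    ε≥0 = /-nonneg 1 k'

    -- k³ ≤ k^ℓ ≤ (1+δ)^ξ, by ℓ ≥ 3 and the choice of ξ
    κ³≤q^ξ : κ * κ * κ ≤ qpow (+ ξ)
    κ³≤q^ξ = begin
      κ * κ * κ              ≡⟨ sym (trans (fromℕ-* (k ℕ.* k) k) (cong (_* κ) (fromℕ-* k k))) ⟩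
      fromℕ (k ℕ.* k ℕ.* k)  ≤⟨ fromℕ-mono k³≤k^ℓ ⟩
      fromℕ (k ℕ.^ ℓ)        ≤⟨ proj₁ isXi ⟩
      qpow (+ ξ) ∎
      where
      open ℚP.≤-Reasoning
      k³≤k^ℓ : k ℕ.* k ℕ.* k ℕ.≤ k ℕ.^ ℓ
      k³≤k^ℓ = subst (ℕ._≤ k ℕ.^ ℓ)
        (trans (cong (λ x → k ℕ.* (k ℕ.* x)) (ℕP.*-identityʳ k)) (sym (ℕP.*-assoc k k k)))
        (ℕP.^-monoʳ-≤ k 3≤ℓ)

    -- (1+δ)^ξ ≥ k^ℓ ≥ k ≥ 2
    2≤q^ξ : fromℕ 2 ≤ qpow (+ ξ)
    2≤q^ξ = ℚP.≤-trans (fromℕ-mono 2≤k^ℓ) (proj₁ isXi)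
      where
      2≤k^ℓ : 2 ℕ.≤ k ℕ.^ ℓ
      2≤k^ℓ = ℕP.≤-trans (ℕP.≤-trans (ℕ.s≤s (ℕ.s≤s ℕ.z≤n)) 8≤k)
        (subst (ℕ._≤ k ℕ.^ ℓ) (ℕP.*-identityʳ k) (ℕP.^-monoʳ-≤ k (ℕP.≤-trans (ℕ.s≤s ℕ.z≤n) 3≤ℓ)))

    ξ≥1 : 1 ℕ.≤ ξ
    ξ≥1 = q^x≥2⇒x≥1 ξ 2≤q^ξ

    open Blocks k' ℓ ξ ζ A ξ≥1 no-gap-job public

    D U : ℤ → ℚ
    D v = qpow (Lo v)
    U v = qpow (Up v)

    D>0 : ∀ v → 0ℚ < D v
    D>0 v = qpow-pos (Lo v)

    U≥0 : ∀ v → 0ℚ ≤ U v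
    U≥0 v = qpow-nonneg (Up v)

    D-mono : ∀ {u v} → u ℤ.≤ v → D u ≤ D v
    D-mono h = qpow-mono (Lo-mono h)

    density-lower : ∀ j → p j * D (blk j) ≤ w j
    density-lower j = begin
      p j * D (blk j)                       ≡⟨ sym (qpow-+ (sizeExp A j) (Lo (blk j))) ⟩
      qpow (sizeExp A j ℤ.+ Lo (blk j))     ≤⟨ qpow-mono (ℤP.+-monoʳ-≤ (sizeExp A j) (Lo≤β j)) ⟩
      qpow (sizeExp A j ℤ.+ β j)            ≡⟨ cong qpow (add-sub (sizeExp A j) (weightExp A j)) ⟩
      w j ∎
      where open ℚP.≤-Reasoning

    density-upper : ∀ j → w j ≤ U (blk j) * p j
    density-upper j = begin
      w j                               ≡⟨ cong qpow (sym (sub-add (weightExp A j) (sizeExp A j))) ⟩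
      qpow (β j ℤ.+ sizeExp A j)        ≤⟨ qpow-mono (ℤP.+-monoˡ-≤ (sizeExp A j) (β≤Up j)) ⟩
      qpow (Up (blk j) ℤ.+ sizeExp A j) ≡⟨ qpow-+ (Up (blk j)) (sizeExp A j) ⟩
      U (blk j) * p j ∎
      where open ℚP.≤-Reasoning

    -- U v · k³ ≤ U v · (1+δ)^(ξ+1) = D (v+1): the gap separates the blocks
    separation : ∀ v → U v * (κ * κ * κ) ≤ D (ℤ.suc v)
    separation v = begin
      U v * (κ * κ * κ)          ≤⟨ *-monoˡ (U v) (U≥0 v) (ℚP.≤-trans κ³≤q^ξ (qpow-mono (ℤP.i≤i+j (+ ξ) (+ 1)))) ⟩
      U v * qpow (+ ξ ℤ.+ + 1)   ≡⟨ sym (qpow-+ (Up v) (+ ξ ℤ.+ + 1)) ⟩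
      qpow (Up v ℤ.+ (+ ξ ℤ.+ + 1)) ≡⟨ cong qpow (sym (Lo-after-Up v)) ⟩
      D (ℤ.suc v) ∎
      where open ℚP.≤-Reasoning

    -- D (v+1) = D v · (1+δ)^M ≥ 2 D v
    doubling : ∀ u → D u + D u ≤ D (ℤ.suc u)
    doubling u = begin
      D u + D u             ≡⟨ solve 1 (λ d → d :+ d := d :* (con 1ℚ :+ con 1ℚ)) refl (D u) ⟩
      D u * (1ℚ + 1ℚ)       ≡⟨ cong (D u *_) (sym (fromℕ-+ 1 1)) ⟩
      D u * fromℕ 2         ≤⟨ *-monoˡ (D u) (ℚP.<⇒≤ (D>0 u)) (ℚP.≤-trans 2≤q^ξ (qpow-mono (ℤ.+≤+ ξ≤M))) ⟩
      D u * qpow (+ M)      ≡⟨ sym (qpow-+ (Lo u) (+ M)) ⟩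
      qpow (Lo u ℤ.+ + M)   ≡⟨ cong qpow (sym (Lo-suc u)) ⟩
      D (ℤ.suc u) ∎
      where open ℚP.≤-Reasoning

    -- a range of block indices containing every block: [-Σ|blk|, Σ|blk|]
    bound : ℕ
    bound = sum (map (λ j → ℤ.∣ blk j ∣) (allFin n))

    blocks : List ℤ
    blocks = range (ℤ.- (+ bound)) (suc (bound ℕ.+ bound))

    ∣blk∣≤bound : ∀ j → ℤ.∣ blk j ∣ ℕ.≤ bound
    ∣blk∣≤bound j = ∈⇒≤sum (∈-map⁺ (λ j → ℤ.∣ blk j ∣) (∈-allFin j))

    select-block : ∀ j (g : ℤ → ℚ) → Σl blocks (λ v → ind ⌊ v ℤ.≟ blk j ⌋ (g v)) ≡ g (blk j)
    select-block j g = range-select (suc (bound ℕ.+ bound)) (ℤ.- (+ bound)) (blk j) g (lower (blk j) (∣blk∣≤bound j))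
      (subst (blk j ℤ.<_) (sym width) (ℤP.≤-<-trans (upper (blk j) (∣blk∣≤bound j)) (ℤ.+<+ (ℕP.n<1+n bound))))
      where
      lower : ∀ z → ℤ.∣ z ∣ ℕ.≤ bound → ℤ.- (+ bound) ℤ.≤ z
      lower (+ x)    _ = ℤP.≤-trans (ℤP.neg-mono-≤ (ℤ.+≤+ ℕ.z≤n)) (ℤ.+≤+ ℕ.z≤n)
      lower -[1+ x ] h = ℤP.neg-mono-≤ (ℤ.+≤+ h)
      upper : ∀ z → ℤ.∣ z ∣ ℕ.≤ bound → z ℤ.≤ + bound
      upper (+ x)    h = ℤ.+≤+ h
      upper -[1+ x ] _ = ℤ.-≤+
      width : ℤ.- (+ bound) ℤ.+ + suc (bound ℕ.+ bound) ≡ + suc bound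
      width = range-width (+ bound)

    geometric : ∀ b → Σl blocks (λ v → ind ⌊ v ℤ.<? b ⌋ (D (ℤ.suc v))) ≤ D b + D b
    geometric = doubling-sum D (λ u → ℚP.<⇒≤ (D>0 u)) D-mono doubling (suc (bound ℕ.+ bound)) (ℤ.- (+ bound))


module Assembly where

  open import Defs
  open FiniteSums
  open RationalFacts
  open Powers
  open ScheduleCost
  open CrossTerm
  open BlockBounds
  open import Data.Nat as ℕ using (ℕ; suc)
  open import Data.Integer as ℤ using (ℤ; +_)
  import Data.Integer.Properties as ℤP
  open import Data.Rational using (ℚ; 0ℚ; 1ℚ; _+_; _*_; _≤_; _<_; _/_)
  import Data.Rational.Properties as ℚP
  open import Data.Bool using (Bool; true; false; _∧_)
  import Data.Bool.Properties as BoolP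
  open import Data.Fin as Fin using (Fin)
  import Data.Fin.Properties as FinP
  open import Data.Product using (Σ; _,_; proj₁; proj₂)
  open import Data.Empty using (⊥-elim)
  open import Relation.Nullary using (¬_)
  open import Relation.Nullary.Decidable using (⌊_⌋; yes; no)
  open import Relation.Binary.PropositionalEquality
  open import Data.Rational.Solver
  open +-*-Solver

  module Combination (k' ℓ ξ ζ : ℕ) {n m : ℕ} (A : Instance n m)
    (3≤ℓ : 3 ℕ.≤ ℓ) (8≤k : 8 ℕ.≤ suc k') (isXi : IsXi (suc k') ℓ ξ)
    (no-gap-job : ∀ (j : Fin n) (v : ℤ) → ¬ inGap (suc k') ℓ ξ ζ v (densityExp A j)) where

    open Bounds k' ℓ ξ ζ A 3≤ℓ 8≤k isXi no-gap-job
    open Schedules k' A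
    open OnePlusδPowers k' using (k)

    I : ℤ → JobSet n
    I v = blockJobs k ℓ ξ ζ A v

    total same cross : Assignment n m → ℚ
    total a = ΣΣ jobs (delay a)
    same  a = ΣΣ jobs (λ j i → ind ⌊ blk j ℤ.≟ blk i ⌋ (delay a j i))
    cross a = ΣΣ jobs (λ j i → ind ⌊ blk j ℤ.<? blk i ⌋ (delay a j i))

    -- a job is never delayed by a job of a lower block
    total≡same+cross : ∀ a → total a ≡ same a + cross a
    total≡same+cross a = trans (ΣΣ-cong jobs split) (ΣΣ-+ jobs _ _)
      where
      split : ∀ j i → delay a j i ≡ ind ⌊ blk j ℤ.≟ blk i ⌋ (delay a j i) + ind ⌊ blk j ℤ.<? blk i ⌋ (delay a j i)
      split j i = ind-partition ⌊ blk j ℤ.≟ blk i ⌋ ⌊ blk j ℤ.<? blk i ⌋ (delay a j i)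
        (λ e l → ℤP.<-irrefl (witness (blk j ℤ.≟ blk i) e) (witness (blk j ℤ.<? blk i) l))
        (λ ≢ ≮ → ind-false (⌊ a i Fin.≟ a j ⌋ ∧ prec i j)
          (λ e → refute (blk j ℤ.<? blk i) ≮
                   (ℤP.≤∧≢⇒< (blk-mono (precedes⇒≥ i j (∧-proj₂ ⌊ a i Fin.≟ a j ⌋ e))) (refute (blk j ℤ.≟ blk i) ≢))))

    blk<⇒β< : ∀ {i j} → blk j ℤ.< blk i → β j ℤ.< β i
    blk<⇒β< l = ℤP.≰⇒> (λ β≤ → ℤP.<-irrefl refl (ℤP.<-≤-trans l (blk-mono β≤)))

    module OnMachine (E : Fin n → Bool) =
      CrossTermBound p w prec blk blocks D U κ ε p≥0 w≥0 precedes-total density-lower density-upper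
                     U≥0 D>0 separation geometric select-block κε≡1 κ≥0 ε≥0 E

    α : ℚ
    α = (ε + ε) + ε * ε

    cross≤ : ∀ a → cross a ≤ α * total a
    cross≤ a = begin
      cross a ≡⟨ ΣΣ-cong jobs across ⟩
      ΣΣ jobs (λ j i → ind (⌊ a i Fin.≟ a j ⌋ ∧ ⌊ blk j ℤ.<? blk i ⌋) (σ (a j) * (w j * p i)))
        ≡⟨ split-machines a (λ j i → ⌊ blk j ℤ.<? blk i ⌋) ⟩
      Σl machines (λ μ → σ μ * OnMachine.cross-cost (onMachine a μ))
        ≤⟨ Σl-mono machines (λ μ → *-monoˡ (σ μ) (σ≥0 μ) (OnMachine.cross-cost-bound (onMachine a μ))) ⟩
      Σl machines (λ μ → σ μ * (α * OnMachine.total-cost (onMachine a μ)))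
        ≡⟨ Σl-cong machines (λ μ → solve 3 (λ s a t → s :* (a :* t) := a :* (s :* t)) refl (σ μ) α _) ⟩
      Σl machines (λ μ → α * (σ μ * OnMachine.total-cost (onMachine a μ)))
        ≡⟨ sym (Σl-* machines α _) ⟩
      α * Σl machines (λ μ → σ μ * OnMachine.total-cost (onMachine a μ))
        ≡⟨ cong (α *_) (sym (split-machines a (λ j i → prec i j))) ⟩
      α * total a ∎
      where
      open ℚP.≤-Reasoning
      -- across blocks, i precedes j exactly when blk j < blk i
      across : ∀ j i → ind ⌊ blk j ℤ.<? blk i ⌋ (delay a j i)
                       ≡ ind (⌊ a i Fin.≟ a j ⌋ ∧ ⌊ blk j ℤ.<? blk i ⌋) (σ (a j) * (w j * p i))
      across j i = trans (sym (ind-∧ ⌊ blk j ℤ.<? blk i ⌋ (⌊ a i Fin.≟ a j ⌋ ∧ prec i j) _))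
        (ind-≡-ind (⌊ blk j ℤ.<? blk i ⌋ ∧ (⌊ a i Fin.≟ a j ⌋ ∧ prec i j)) (⌊ a i Fin.≟ a j ⌋ ∧ ⌊ blk j ℤ.<? blk i ⌋) _
          (λ e → ∧-intro (∧-proj₁ ⌊ a i Fin.≟ a j ⌋ (∧-proj₂ ⌊ blk j ℤ.<? blk i ⌋ e)) (∧-proj₁ ⌊ blk j ℤ.<? blk i ⌋ e))
          (λ e → ∧-intro (∧-proj₂ ⌊ a i Fin.≟ a j ⌋ e)
                   (∧-intro (∧-proj₁ ⌊ a i Fin.≟ a j ⌋ e)
                            (>⇒precedes i j (blk<⇒β< (witness (blk j ℤ.<? blk i) (∧-proj₂ ⌊ a i Fin.≟ a j ⌋ e)))))))

    same≡Σcost : ∀ a → same a ≡ Σl blocks (λ v → cost k A (I v) a)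
    same≡Σcost a = sym (begin
      Σl blocks (λ v → cost k A (I v) a) ≡⟨ Σl-cong blocks (λ v → cost-as-delays (I v) a) ⟩
      Σl blocks (λ v → ΣΣ jobs (λ j i → ind (I v j ∧ I v i) (delay a j i)))
        ≡⟨ Σl-cong blocks (λ v → ΣΣ-cong jobs (λ j i →
             trans (cong₂ (λ b c → ind (b ∧ c) (delay a j i)) (blockJobs≡ v j) (blockJobs≡ v i)) (ind-∧ ⌊ v ℤ.≟ blk j ⌋ _ _))) ⟩
      Σl blocks (λ v → ΣΣ jobs (λ j i → ind ⌊ v ℤ.≟ blk j ⌋ (ind ⌊ v ℤ.≟ blk i ⌋ (delay a j i))))
        ≡⟨ Σl-ΣΣ blocks jobs _ ⟩
      ΣΣ jobs (λ j i → Σl blocks (λ v → ind ⌊ v ℤ.≟ blk j ⌋ (ind ⌊ v ℤ.≟ blk i ⌋ (delay a j i))))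
        ≡⟨ ΣΣ-cong jobs (λ j i → select-block j (λ v → ind ⌊ v ℤ.≟ blk i ⌋ (delay a j i))) ⟩
      same a ∎)
      where open ≡-Reasoning

    same≤total : ∀ a → same a ≤ total a
    same≤total a = ΣΣ-mono jobs (λ j i → ind-≤ ⌊ blk j ℤ.≟ blk i ⌋ (delay≥0 a j i))

    8ε≤1 : fromℕ 8 * ε ≤ 1ℚ
    8ε≤1 = ℚP.≤-trans (*-monoʳ ε ε≥0 (fromℕ-mono 8≤k)) (ℚP.≤-reflexive κε≡1)

    total≤same : ∀ a → total a ≤ (1ℚ + fromℕ 8 * ε) * same a
    total≤same a = absorb-cross (total≡same+cross a) (cross≤ a) (ΣΣ-nonneg jobs (delay≥0 a)) ε≥0 8ε≤1

    module _ (ν : ℚ) (1+ν≥0 : 0ℚ ≤ 1ℚ + ν) (sol : ℤ → Assignment n m)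
      (sol-approx : ∀ (v : ℤ) → Σ (Fin n) (λ j → I v j ≡ true) →
                    cost k A (I v) (sol v) ≤ (1ℚ + ν) * OPT k A (I v))
      (a : Assignment n m) (a-agrees : ∀ (v : ℤ) (j : Fin n) → I v j ≡ true → a j ≡ sol v j) where

      block-approx : ∀ o v → cost k A (I v) a ≤ (1ℚ + ν) * cost k A (I v) o
      block-approx o v with FinP.any? (λ j → I v j BoolP.≟ true)
      ... | yes nonempty = begin
        cost k A (I v) a          ≡⟨ cost-cong (I v) a (sol v) (a-agrees v) ⟩
        cost k A (I v) (sol v)    ≤⟨ sol-approx v nonempty ⟩
        (1ℚ + ν) * OPT k A (I v)  ≤⟨ *-monoˡ (1ℚ + ν) 1+ν≥0 (OPT-≤ (I v) o) ⟩
        (1ℚ + ν) * cost k A (I v) o ∎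
        where open ℚP.≤-Reasoning
      ... | no empty = subst (_≤ (1ℚ + ν) * cost k A (I v) o) (sym (cost-empty (I v) a none))
                             (mul-nonneg 1+ν≥0 (cost-nonneg (I v) o))
        where
        none : ∀ j → I v j ≡ false
        none j with I v j in e
        ... | false = refl
        ... | true  = ⊥-elim (empty (j , e))

      -- S(a) ≤ (1+ν) S(o) ≤ (1+ν) T(o) = (1+ν) OPT for an optimal o
      same≤OPT : same a ≤ (1ℚ + ν) * OPT k A allJobs
      same≤OPT = begin
        same a                                   ≡⟨ same≡Σcost a ⟩
        Σl blocks (λ v → cost k A (I v) a)       ≤⟨ Σl-mono blocks (block-approx o) ⟩
        Σl blocks (λ v → (1ℚ + ν) * cost k A (I v) o) ≡⟨ sym (Σl-* blocks (1ℚ + ν) _) ⟩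
        (1ℚ + ν) * Σl blocks (λ v → cost k A (I v) o) ≡⟨ cong ((1ℚ + ν) *_) (sym (same≡Σcost o)) ⟩
        (1ℚ + ν) * same o                        ≤⟨ *-monoˡ (1ℚ + ν) 1+ν≥0 (same≤total o) ⟩
        (1ℚ + ν) * total o                       ≡⟨ cong ((1ℚ + ν) *_) (sym (trans (proj₂ (OPT-attained allJobs)) (cost-as-delays allJobs o))) ⟩
        (1ℚ + ν) * OPT k A allJobs ∎
        where
        open ℚP.≤-Reasoning
        o = proj₁ (OPT-attained allJobs)

      combined-bound : cost k A allJobs a ≤ (1ℚ + ν) * (1ℚ + (+ 8) / k) * OPT k A allJobs
      combined-bound = begin
        cost k A allJobs a                                   ≡⟨ cost-as-delays allJobs a ⟩
        total a                                              ≤⟨ total≤same a ⟩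
        (1ℚ + fromℕ 8 * ε) * same a                          ≤⟨ *-monoˡ _ 1+8ε≥0 same≤OPT ⟩
        (1ℚ + fromℕ 8 * ε) * ((1ℚ + ν) * OPT k A allJobs)   ≡⟨ cong (λ x → (1ℚ + x) * ((1ℚ + ν) * OPT k A allJobs)) (sym (/-as-* 8 k')) ⟩
        (1ℚ + (+ 8) / k) * ((1ℚ + ν) * OPT k A allJobs)
          ≡⟨ solve 3 (λ e v o → e :* (v :* o) := v :* e :* o) refl (1ℚ + (+ 8) / k) (1ℚ + ν) (OPT k A allJobs) ⟩
        (1ℚ + ν) * (1ℚ + (+ 8) / k) * OPT k A allJobs ∎
        where
        open ℚP.≤-Reasoning
        1+8ε≥0 : 0ℚ ≤ 1ℚ + fromℕ 8 * ε
        1+8ε≥0 = +-nonneg (ℚP.nonNegative⁻¹ 1ℚ) (mul-nonneg (fromℕ-nonneg 8) ε≥0)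


open import Defs
open import Data.Nat as ℕ using (ℕ; NonZero)
open import Data.Integer as ℤ using (ℤ; +_)
open import Data.Rational as ℚ using (ℚ; 0ℚ; 1ℚ; _/_)
import Data.Rational.Properties as ℚP
open import Data.Fin using (Fin)
open import Data.Bool using (true)
open import Data.Product using (Σ)
open import Relation.Nullary using (¬_)
open import Relation.Binary.PropositionalEquality using (_≡_)

-- The theorem, for k = 1/δ = k' + 1.
mainTheorem8 :
    (k : ℕ) .{{_ : NonZero k}} → 8 ℕ.≤ k →
    (ℓ : ℕ) → 3 ℕ.≤ ℓ → ℓ ℕ.≤ 5 →
    (ξ : ℕ) → IsXi k ℓ ξ →
    (ζ : ℕ) → ζ ℕ.< k ℕ.^ (ℓ ℕ.+ 1) →
    {n m : ℕ} (A : Instance n m) →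
    (∀ (j : Fin n) (v : ℤ) → ¬ inGap k ℓ ξ ζ v (densityExp A j)) →
    (ν : ℚ) → 0ℚ ℚ.< ν →
    (sol : ℤ → Assignment n m) →
    (∀ (v : ℤ) → Σ (Fin n) (λ j → blockJobs k ℓ ξ ζ A v j ≡ true) →
      cost k A (blockJobs k ℓ ξ ζ A v) (sol v)
        ℚ.≤ (1ℚ ℚ.+ ν) ℚ.* OPT k A (blockJobs k ℓ ξ ζ A v)) →
    (a : Assignment n m) →
    (∀ (v : ℤ) (j : Fin n) → blockJobs k ℓ ξ ζ A v j ≡ true → a j ≡ sol v j) →
    cost k A allJobs a
      ℚ.≤ (1ℚ ℚ.+ ν) ℚ.* (1ℚ ℚ.+ ((+ 8) / k)) ℚ.* OPT k A allJobs
mainTheorem8 (ℕ.suc k') 8≤k ℓ 3≤ℓ _ ξ isXi ζ _ A no-gap-job ν ν>0 sol sol-approx a a-agrees =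
  Assembly.Combination.combined-bound k' ℓ ξ ζ A 3≤ℓ 8≤k isXi no-gap-job
    ν (RationalFacts.+-nonneg (ℚP.nonNegative⁻¹ 1ℚ) (ℚP.<⇒≤ ν>0)) sol sol-approx a a-agrees
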